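{- Let $T=(V,E)$ be a tree on at least $4$ vertices all of whose vertices have degree one or three. Then $\mathrm{sp}^*(T,V\cup E^*(T))\ge h_1(T)=|E^*(T)|+3$.
   Context: A path in $T$ is a sequence of distinct vertices $v_0\dots v_l$ ($l\ge0$) with consecutive ones adjacent; it contains its vertices and the edges $v_{i-1}v_i$. For a family $\mathcal F$ of paths and an element $s$ (vertex or edge), $\mathcal F(s)$ is the set of paths containing $s$. For $S\subseteq V\cup E$, $\mathcal F$ separates $S$ if $\mathcal F(s)\neq\mathcal F(t)$ for distinct $s,t\in S$ and covers $S$ if each $\mathcal F(s)$ is nonempty; $\mathrm{sp}^*(T,S)$ is the minimum size of a family separating and covering $S$. $h_1(T)$ is the number of leaves. $E^*(T)$ is the set of interior edges, i.e. edges $uv$ with neither $u$ nor $v$ a leaf. -}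

module Defs where

open import Data.Nat using (ℕ; _≤_; _<_; _+_)
open import Data.Bool using (Bool; true; false; _∧_; _∨_; if_then_else_)
open import Data.Fin using (Fin) renaming (_<_ to _<ᶠ_)
open import Data.Fin.Properties using (_≟_)
open import Data.Fin.Subset using (Subset) renaming (⊥ to ∅)
open import Data.List using (List; []; _∷_; _++_; [_]; length; filterᵇ; allFin; concatMap; map)
open import Data.List.Relation.Unary.Unique.Propositional using (Unique)
open import Data.List.Relation.Unary.Linked using (Linked)
open import Data.Bool.ListAction using (any)
open import Data.Vec using (tabulate)
open import Data.Product using (Σ; ∃; _×_; _,_)
open import Data.Empty using (⊥)
open import Relation.Nullary using (¬_; Dec; yes; no)
open import Relation.Nullary.Decidable using (⌊_⌋)
open import Relation.Binary.PropositionalEquality using (_≡_; _≢_)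

record Graph (n : ℕ) : Set where
  field
    adj   : Fin n → Fin n → Bool
    sym   : ∀ u v → adj u v ≡ adj v u
    irrefl : ∀ v → adj v v ≡ false
open Graph public

module _ {n : ℕ} (G : Graph n) where

  Adj : Fin n → Fin n → Set
  Adj u v = adj G u v ≡ true

  IsPath : List (Fin n) → Set
  IsPath []       = ⊥
  IsPath (x ∷ xs) = Unique (x ∷ xs) × Linked Adj (x ∷ xs)

  lastOf : Fin n → List (Fin n) → Fin n
  lastOf x []       = x
  lastOf x (y ∷ ys) = lastOf y ys

  IsPathFromTo : Fin n → Fin n → List (Fin n) → Set
  IsPathFromTo u v []       = ⊥
  IsPathFromTo u v (x ∷ xs) = IsPath (x ∷ xs) × x ≡ u × lastOf x xs ≡ v

  Connected : Set
  Connected = ∀ u v → ∃ λ p → IsPathFromTo u v p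

  IsCycle : List (Fin n) → Set
  IsCycle []       = ⊥
  IsCycle (x ∷ xs) = 3 ≤ length (x ∷ xs) × Unique (x ∷ xs) × Linked Adj (x ∷ xs ++ [ x ])

  Acyclic : Set
  Acyclic = ∀ c → ¬ IsCycle c

  IsTree : Set
  IsTree = 1 ≤ n × Connected × Acyclic

  deg : Fin n → ℕ
  deg v = length (filterᵇ (adj G v) (allFin n))

  isLeaf : Fin n → Bool
  isLeaf v = ⌊ deg v Data.Nat.≟ 1 ⌋
    where import Data.Nat

  h₁ : ℕ
  h₁ = length (filterᵇ isLeaf (allFin n))

  not : Bool → Bool
  not true = false
  not false = true

  -- unordered pairs {u,v} are represented canonically by u < v
  isInteriorEdge : Fin n → Fin n → Bool
  isInteriorEdge u v = ⌊ Data.Fin._<?_ u v ⌋ ∧ adj G u v ∧ not (isLeaf u) ∧ not (isLeaf v)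
    where import Data.Fin

  numInteriorEdges : ℕ
  numInteriorEdges =
    length (concatMap (λ u → filterᵇ (isInteriorEdge u) (allFin n)) (allFin n))

  data Elem : Set where
    vtx : Fin n → Elem
    edg : Fin n → Fin n → Elem   -- edg u v stands for the edge {u,v}, with u < v

  InVE* : Elem → Set
  InVE* (vtx v)   = Data.Unit.⊤
    where import Data.Unit
  InVE* (edg u v) = isInteriorEdge u v ≡ true

  record Path : Set where
    field
      verts  : List (Fin n)
      isPath : IsPath verts
  open Path public

  eqᵇ : Fin n → Fin n → Bool
  eqᵇ a b = ⌊ a ≟ b ⌋

  hasEdge : Fin n → Fin n → List (Fin n) → Bool
  hasEdge u v (a ∷ b ∷ rest) =
    ((eqᵇ a u ∧ eqᵇ b v) ∨ (eqᵇ a v ∧ eqᵇ b u)) ∨ hasEdge u v (b ∷ rest)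
  hasEdge u v _ = false

  contains : Path → Elem → Bool
  contains P (vtx v)   = any (eqᵇ v) (verts P)
  contains P (edg u v) = hasEdge u v (verts P)

  famAt : {k : ℕ} → (Fin k → Path) → Elem → Subset k
  famAt 𝓕 s = tabulate (λ i → contains (𝓕 i) s)

  Separates : {k : ℕ} → (Fin k → Path) → (Elem → Set) → Set
  Separates 𝓕 S = ∀ s t → S s → S t → s ≢ t → famAt 𝓕 s ≢ famAt 𝓕 t

  Covers : {k : ℕ} → (Fin k → Path) → (Elem → Set) → Set
  Covers 𝓕 S = ∀ s → S s → famAt 𝓕 s ≢ ∅

{-# OPTIONS --safe #-}
-- Attach each leaf to its unique neighbour and each interior vertex to itself. Around an interior
-- vertex u with ℓ leaf neighbours, covering and separating u, its leaves and its interior edges forces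
-- at least 2ℓ path endpoints attached to u; this is a finite check over the ways a path can meet u
-- and its three neighbours. As every path has two endpoints, 2k ≥ 2h₁.
-- The identity is double counting: a tree has n - 1 edges, so h₁ is the number of interior vertices
-- plus 2, and counting the edges at interior vertices gives 3·#interior = 2|E*| + h₁.
module Submission where

import Data.Nat as ℕ
open import Data.Nat using (ℕ; zero; suc; _+_; _*_; _∸_; _≤_; _<_; _≤ᵇ_; z≤n; s≤s)
open import Data.Nat.Properties
  using ( +-*-semiring; module ≤-Reasoning; ≤-refl; ≤-reflexive; ≤-trans; ≤ᵇ⇒≤; <-irrefl; n≤0⇒n≡0
        ; +-identityʳ; +-comm; +-assoc; +-cancelʳ-≡; +-cancelˡ-≡; +-mono-≤; +-monoʳ-≤; m≤m+n; m≤n+m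
        ; *-cancelˡ-≡; *-cancelˡ-≤; *-monoʳ-≤; ∸-monoˡ-≤; m+n∸n≡m )
open import Data.Nat.Tactic.RingSolver using (solve-∀)
open import Algebra.Properties.Semiring.Sum +-*-semiring
  using (sum-syntax; sum-cong-≗; ∑-distrib-+; ∑-comm; *-distribˡ-sum)
open import Data.Bool using (T; Bool; true; false; _∧_; _∨_; not; if_then_else_; _xor_)
import Data.Bool.Properties as Bool
open import Data.Bool.Properties using (∨-comm; ∧-comm; ∧-zeroʳ; ∧-identityʳ)
open import Data.Bool.ListAction using (any)
open import Data.Fin using (Fin; zero; suc; _<?_) renaming (_<_ to _<ᶠ_)
open import Data.Fin.Properties using (_≟_; suc-injective; <-cmp; any?; ¬∀⟶∃¬)
open import Data.List using (List; []; _∷_; _++_; [_]; length; filterᵇ; allFin; concatMap; tabulate)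
open import Data.List.Properties using (length-++; ++-assoc; ∷-injective; ∷-injectiveˡ)
open import Data.List.Relation.Unary.Any using (here; there)
open import Data.List.Relation.Unary.All using (All; []; _∷_)
import Data.List.Relation.Unary.All as All
import Data.List.Relation.Unary.All.Properties as All
open import Data.List.Relation.Unary.AllPairs using ([]; _∷_)
open import Data.List.Relation.Unary.Unique.Propositional using (Unique)
open import Data.List.Relation.Unary.Unique.Propositional.Properties using (Unique[x∷xs]⇒x∉xs)
open import Data.List.Relation.Unary.Linked using (Linked; []; [-]; _∷_)
import Data.List.Relation.Unary.Linked as Linked
open import Data.List.Membership.Propositional using (_∈_; _∉_)
open import Data.List.Membership.Propositional.Properties using (∈-∃++; ∈-++⁺ˡ)
import Data.List.Membership.DecPropositional as DecMembership
open import Data.Vec using (Vec; []; _∷_; lookup; replicate; _[_]≔_)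
import Data.Vec as Vec
open import Data.Vec.Properties using (tabulate-cong; tabulate∘lookup; lookup-replicate; lookup∘update; lookup∘update′)
open import Data.Maybe using (Maybe; just; nothing)
open import Data.Product using (Σ; ∃; _×_; _,_; proj₁; proj₂)
open import Data.Sum using (_⊎_; inj₁; inj₂)
open import Data.Empty using (⊥; ⊥-elim)
open import Data.Unit using (tt)
open import Function using (_∘_)
open import Relation.Nullary using (¬_; yes; no)
open import Relation.Nullary.Decidable using (⌊_⌋)
open import Relation.Binary using (tri<; tri≈; tri>)
open import Relation.Binary.PropositionalEquality hiding ([_])
open import Defs hiding (sym; not)

𝟙 : Bool → ℕ
𝟙 true  = 1
𝟙 false = 0

∧-true⁻ˡ : ∀ {x y} → x ∧ y ≡ true → x ≡ true
∧-true⁻ˡ {true} _ = refl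

∧-true⁻ʳ : ∀ {x y} → x ∧ y ≡ true → y ≡ true
∧-true⁻ʳ {true} e = e

∧-true⁺ : ∀ {x y} → x ≡ true → y ≡ true → x ∧ y ≡ true
∧-true⁺ refl refl = refl

∨-true⁻ : ∀ a {b} → a ∨ b ≡ true → a ≡ true ⊎ b ≡ true
∨-true⁻ true  _ = inj₁ refl
∨-true⁻ false e = inj₂ e

∨-true⁺ʳ : ∀ a {b} → b ≡ true → a ∨ b ≡ true
∨-true⁺ʳ true  _ = refl
∨-true⁺ʳ false e = e

true≢false : true ≢ false
true≢false ()

_==_ : ∀ {n} → Fin n → Fin n → Bool
a == b = ⌊ a ≟ b ⌋

==-refl : ∀ {n} (a : Fin n) → a == a ≡ true
==-refl a with a ≟ a
... | yes _ = refl
... | no a≢a = ⊥-elim (a≢a refl)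

==⇒≡ : ∀ {n} {a b : Fin n} → a == b ≡ true → a ≡ b
==⇒≡ {a = a} {b} e with a ≟ b
... | yes a≡b = a≡b

≢⇒==false : ∀ {n} {a b : Fin n} → a ≢ b → a == b ≡ false
≢⇒==false {a = a} {b} a≢b with a ≟ b
... | yes a≡b = ⊥-elim (a≢b a≡b)
... | no _ = refl

==-sym : ∀ {n} (a b : Fin n) → a == b ≡ b == a
==-sym a b with a ≟ b | b ≟ a
... | yes _   | yes _   = refl
... | yes a≡b | no b≢a  = ⊥-elim (b≢a (sym a≡b))
... | no a≢b  | yes b≡a = ⊥-elim (a≢b (sym b≡a))
... | no _    | no _    = refl

==-suc : ∀ {n} (a b : Fin n) → suc a == suc b ≡ a == b
==-suc a b with a ≟ b | suc a ≟ suc b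
... | yes _   | yes _   = refl
... | yes a≡b | no sa≢sb = ⊥-elim (sa≢sb (cong suc a≡b))
... | no a≢b  | yes sa≡sb = ⊥-elim (a≢b (suc-injective sa≡sb))
... | no _    | no _    = refl

<?-true : ∀ {n} {a b : Fin n} → a <ᶠ b → ⌊ a <? b ⌋ ≡ true
<?-true {a = a} {b} a<b with a <? b
... | yes _   = refl
... | no a≮b = ⊥-elim (a≮b a<b)

<?-false : ∀ {n} {a b : Fin n} → ¬ a <ᶠ b → ⌊ a <? b ⌋ ≡ false
<?-false {a = a} {b} a≮b with a <? b
... | yes a<b = ⊥-elim (a≮b a<b)
... | no _    = refl

not-==⇒≢ : ∀ {n} {a b : Fin n} → not (a == b) ≡ true → a ≢ b
not-==⇒≢ {a = a} e refl rewrite ==-refl a = true≢false (sym e)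

∑-zero : ∀ n → ∑[ i < n ] 0 ≡ 0
∑-zero zero    = refl
∑-zero (suc n) = ∑-zero n

∑-one : ∀ n → ∑[ i < n ] 1 ≡ n
∑-one zero    = refl
∑-one (suc n) = cong suc (∑-one n)

∑-mono-≤ : ∀ {n} {f g : Fin n → ℕ} → (∀ i → f i ≤ g i) → ∑[ i < n ] f i ≤ ∑[ i < n ] g i
∑-mono-≤ {zero}  f≤g = z≤n
∑-mono-≤ {suc n} f≤g = +-mono-≤ (f≤g zero) (∑-mono-≤ (f≤g ∘ suc))

term≤∑ : ∀ {n} (f : Fin n → ℕ) i → f i ≤ ∑[ j < n ] f j
term≤∑ f zero    = m≤m+n _ _
term≤∑ f (suc i) = ≤-trans (term≤∑ (f ∘ suc) i) (m≤n+m _ _)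

two-terms≤∑ : ∀ {n} (f : Fin n → ℕ) i j → i ≢ j → f i + f j ≤ ∑[ k < n ] f k
two-terms≤∑ f zero    zero    i≢j = ⊥-elim (i≢j refl)
two-terms≤∑ f zero    (suc j) _   = +-monoʳ-≤ (f zero) (term≤∑ (f ∘ suc) j)
two-terms≤∑ f (suc i) zero    _   =
  subst (_≤ f zero + ∑[ k < _ ] f (suc k)) (+-comm (f zero) (f (suc i))) (+-monoʳ-≤ (f zero) (term≤∑ (f ∘ suc) i))
two-terms≤∑ f (suc i) (suc j) i≢j = ≤-trans (two-terms≤∑ (f ∘ suc) i j (i≢j ∘ cong suc)) (m≤n+m _ _)

∑≡0⇒≡0 : ∀ {n} (f : Fin n → ℕ) → ∑[ i < n ] f i ≡ 0 → ∀ i → f i ≡ 0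
∑≡0⇒≡0 f ∑f≡0 i = n≤0⇒n≡0 (subst (f i ≤_) ∑f≡0 (term≤∑ f i))

∑>0⇒∃ : ∀ {n} (f : Fin n → ℕ) → 0 < ∑[ i < n ] f i → ∃ λ i → 0 < f i
∑>0⇒∃ {suc n} f pos with f zero in eq
... | suc _ = zero , subst (0 <_) (sym eq) (s≤s z≤n)
... | zero with ∑>0⇒∃ (f ∘ suc) pos
...   | i , fi>0 = suc i , fi>0

∑-select : ∀ {n} (v : Fin n) (g : Fin n → ℕ) → ∑[ u < n ] (if v == u then g u else 0) ≡ g v
∑-select {suc n} zero g = trans (cong (g zero +_) (∑-zero n)) (+-identityʳ _)
∑-select {suc n} (suc v) g =
  trans (sum-cong-≗ (λ i → cong (λ b → if b then g (suc i) else 0) (==-suc v i))) (∑-select v (g ∘ suc))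

∑-𝟙-== : ∀ {n} (v : Fin n) → ∑[ u < n ] 𝟙 (v == u) ≡ 1
∑-𝟙-== {n} v = trans (sum-cong-≗ (λ u → 𝟙-as-if (v == u))) (∑-select v (λ _ → 1))
  where
  𝟙-as-if : ∀ b → 𝟙 b ≡ (if b then 1 else 0)
  𝟙-as-if true  = refl
  𝟙-as-if false = refl

∑-𝟙-∧-== : ∀ {n} (c : Bool) (v : Fin n) → ∑[ u < n ] 𝟙 (c ∧ v == u) ≡ 𝟙 c
∑-𝟙-∧-== true  v = ∑-𝟙-== v
∑-𝟙-∧-== {n} false v = ∑-zero n

true⇒1≤∑𝟙 : ∀ {n} (g : Fin n → Bool) i → g i ≡ true → 1 ≤ ∑[ j < n ] 𝟙 (g j)
true⇒1≤∑𝟙 g i e = subst (_≤ ∑[ j < _ ] 𝟙 (g j)) (cong 𝟙 e) (term≤∑ (𝟙 ∘ g) i)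

true²⇒2≤∑𝟙 : ∀ {n} (g : Fin n → Bool) i j → i ≢ j → g i ≡ true → g j ≡ true → 2 ≤ ∑[ k < n ] 𝟙 (g k)
true²⇒2≤∑𝟙 g i j i≢j e e′ = subst (_≤ ∑[ k < _ ] 𝟙 (g k)) (cong₂ (λ a b → 𝟙 a + 𝟙 b) e e′) (two-terms≤∑ (𝟙 ∘ g) i j i≢j)

≢true⇒𝟙≡0 : ∀ {b} → b ≢ true → 𝟙 b ≡ 0
≢true⇒𝟙≡0 {false} _ = refl
≢true⇒𝟙≡0 {true}  b≢true = ⊥-elim (b≢true refl)

∑𝟙≤1 : ∀ {n} (g : Fin n → Bool) → (∀ i j → g i ≡ true → g j ≡ true → i ≡ j) → ∑[ i < n ] 𝟙 (g i) ≤ 1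
∑𝟙≤1 {zero}  g _    = z≤n
∑𝟙≤1 {suc n} g at-most-one with g zero in g0
... | false = ∑𝟙≤1 (g ∘ suc) (λ i j gi gj → suc-injective (at-most-one (suc i) (suc j) gi gj))
... | true  = s≤s (≤-reflexive (trans (sum-cong-≗ (λ i → ≢true⇒𝟙≡0 (λ gi → 0≢suc (at-most-one zero (suc i) g0 gi)))) (∑-zero n)))
  where
  0≢suc : ∀ {i : Fin n} → zero ≢ suc i
  0≢suc ()

tabulate-≢⇒∃ : ∀ {k} (g h : Fin k → Bool) → Vec.tabulate g ≢ Vec.tabulate h → ∃ λ i → g i ≢ h i
tabulate-≢⇒∃ g h ne = ¬∀⟶∃¬ _ (λ i → g i ≡ h i) (λ i → g i Bool.≟ h i) (ne ∘ tabulate-cong)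

tabulate-false : ∀ k → Vec.tabulate {k} (λ _ → false) ≡ replicate k false
tabulate-false k = trans (tabulate-cong (λ i → sym (lookup-replicate i false))) (tabulate∘lookup (replicate k false))

length-filterᵇ-allFin : ∀ n (p : Fin n → Bool) → length (filterᵇ p (allFin n)) ≡ ∑[ i < n ] 𝟙 (p i)
length-filterᵇ-allFin n p = go n (λ i → i)
  where
  go : ∀ m (g : Fin m → Fin n) → length (filterᵇ p (tabulate g)) ≡ ∑[ i < m ] 𝟙 (p (g i))
  go zero    g = refl
  go (suc m) g with p (g zero)
  ... | true  = cong suc (go m (g ∘ suc))
  ... | false = go m (g ∘ suc)

length-concatMap-allFin : ∀ n {A : Set} (h : Fin n → List A) →
  length (concatMap h (allFin n)) ≡ ∑[ i < n ] length (h i)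
length-concatMap-allFin n h = go n (λ i → i)
  where
  go : ∀ m (g : Fin m → Fin n) → length (concatMap h (tabulate g)) ≡ ∑[ i < m ] length (h (g i))
  go zero    g = refl
  go (suc m) g = trans (length-++ (h (g zero))) (cong (length (h (g zero)) +_) (go m (g ∘ suc)))

module _ {n : ℕ} where

  private
    𝟙-split : ∀ (x e : Bool) → 𝟙 x ≡ 𝟙 (x ∧ not e) + (if e then 𝟙 x else 0)
    𝟙-split true  true  = refl
    𝟙-split true  false = refl
    𝟙-split false true  = refl
    𝟙-split false false = refl

    ∧-not≡false : ∀ {x e} → x ∧ not e ≡ false → x ≡ true → e ≡ true
    ∧-not≡false {true} {true} _ _ = refl

  count-pick : ∀ (p : Fin n → Bool) {m} → ∑[ z < n ] 𝟙 (p z) ≡ suc m →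
    ∃ λ a → p a ≡ true × ∑[ z < n ] 𝟙 (p z ∧ not (a == z)) ≡ m
  count-pick p {m} count≡ with ∑>0⇒∃ (𝟙 ∘ p) (subst (0 <_) (sym count≡) (s≤s z≤n))
  ... | a , pa>0 = a , pa , +-cancelʳ-≡ 1 _ _ rest+1≡m+1
    where
    pa : p a ≡ true
    pa with p a
    ... | true  = refl
    ... | false = ⊥-elim (<-irrefl refl pa>0)
    rest+1≡m+1 : ∑[ z < n ] 𝟙 (p z ∧ not (a == z)) + 1 ≡ m + 1
    rest+1≡m+1 = begin
        ∑[ z < n ] 𝟙 (p z ∧ not (a == z)) + 1
      ≡⟨ cong (∑[ z < n ] 𝟙 (p z ∧ not (a == z)) +_) (sym (trans (∑-select a (𝟙 ∘ p)) (cong 𝟙 pa))) ⟩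
        ∑[ z < n ] 𝟙 (p z ∧ not (a == z)) + ∑[ z < n ] (if a == z then 𝟙 (p z) else 0)
      ≡⟨ sym (∑-distrib-+ (λ z → 𝟙 (p z ∧ not (a == z))) (λ z → if a == z then 𝟙 (p z) else 0)) ⟩
        ∑[ z < n ] (𝟙 (p z ∧ not (a == z)) + (if a == z then 𝟙 (p z) else 0))
      ≡⟨ sym (sum-cong-≗ (λ z → 𝟙-split (p z) (a == z))) ⟩
        ∑[ z < n ] 𝟙 (p z)
      ≡⟨ count≡ ⟩
        suc m
      ≡⟨ +-comm 1 m ⟩
        m + 1 ∎
      where open ≡-Reasoning

  private
    count-zero : ∀ {a} (q : Fin n → Bool) → ∑[ z < n ] 𝟙 (q z ∧ not (a == z)) ≡ 0 → ∀ z → q z ≡ true → z ≡ a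
    count-zero {a} q count≡0 z qz =
      sym (==⇒≡ (∧-not≡false (𝟙≡0⇒false (∑≡0⇒≡0 (λ z → 𝟙 (q z ∧ not (a == z))) count≡0 z)) qz))
      where
      𝟙≡0⇒false : ∀ {b} → 𝟙 b ≡ 0 → b ≡ false
      𝟙≡0⇒false {false} _ = refl

  count≡1⇒unique : ∀ (p : Fin n → Bool) → ∑[ z < n ] 𝟙 (p z) ≡ 1 → ∃ λ a → p a ≡ true × (∀ z → p z ≡ true → z ≡ a)
  count≡1⇒unique p count≡1 with count-pick p count≡1
  ... | a , pa , rest≡0 = a , pa , count-zero p rest≡0

  count≡3⇒enumeration : ∀ (p : Fin n → Bool) → ∑[ z < n ] 𝟙 (p z) ≡ 3 →
    Σ (Fin 3 → Fin n) λ e →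
      (∀ y → p (e y) ≡ true) × (∀ y y′ → e y ≡ e y′ → y ≡ y′) × (∀ z → p z ≡ true → ∃ λ y → z ≡ e y)
  count≡3⇒enumeration p count≡3 with count-pick p count≡3
  ... | a , pa , count≡2 with count-pick _ count≡2
  ... | b , pb , count≡1 with count-pick _ count≡1
  ... | c , pc , count≡0 = e , e-true , e-injective , e-onto
    where
    e : Fin 3 → Fin n
    e zero             = a
    e (suc zero)       = b
    e (suc (suc zero)) = c
    e-true : ∀ y → p (e y) ≡ true
    e-true zero             = pa
    e-true (suc zero)       = ∧-true⁻ˡ pb
    e-true (suc (suc zero)) = ∧-true⁻ˡ (∧-true⁻ˡ pc)
    a≢b : a ≢ b
    a≢b = not-==⇒≢ (∧-true⁻ʳ pb)
    a≢c : a ≢ c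
    a≢c = not-==⇒≢ (∧-true⁻ʳ {p c} (∧-true⁻ˡ pc))
    b≢c : b ≢ c
    b≢c = not-==⇒≢ (∧-true⁻ʳ pc)
    e-injective : ∀ y y′ → e y ≡ e y′ → y ≡ y′
    e-injective zero             zero             _ = refl
    e-injective (suc zero)       (suc zero)       _ = refl
    e-injective (suc (suc zero)) (suc (suc zero)) _ = refl
    e-injective zero             (suc zero)       eq = ⊥-elim (a≢b eq)
    e-injective zero             (suc (suc zero)) eq = ⊥-elim (a≢c eq)
    e-injective (suc zero)       (suc (suc zero)) eq = ⊥-elim (b≢c eq)
    e-injective (suc zero)       zero             eq = ⊥-elim (a≢b (sym eq))
    e-injective (suc (suc zero)) zero             eq = ⊥-elim (a≢c (sym eq))
    e-injective (suc (suc zero)) (suc zero)       eq = ⊥-elim (b≢c (sym eq))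
    e-onto : ∀ z → p z ≡ true → ∃ λ y → z ≡ e y
    e-onto z pz with a == z in a==z | b == z in b==z
    ... | true | _    = zero , sym (==⇒≡ a==z)
    ... | false | true = suc zero , sym (==⇒≡ b==z)
    ... | false | false = suc (suc zero) , count-zero (λ z → (p z ∧ not (a == z)) ∧ not (b == z)) count≡0 z
                                            (∧-true⁺ (∧-true⁺ pz (cong not a==z)) (cong not b==z))

module _ {A : Set} where

  Unique-++ : ∀ (xs ys : List A) → Unique xs → Unique ys → All (_∉ xs) ys → Unique (xs ++ ys)
  Unique-++ []       ys _          uys _   = uys
  Unique-++ (x ∷ xs) ys (x∉ ∷ uxs) uys dis =
    All.++⁺ x∉ (All.map (λ z∉ x≡z → z∉ (here (sym x≡z))) dis) ∷ Unique-++ xs ys uxs uys (All.map (λ z∉ → z∉ ∘ there) dis)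

  Unique-prefix : ∀ (xs ys : List A) → Unique (xs ++ ys) → Unique xs
  Unique-prefix []       ys _         = []
  Unique-prefix (x ∷ xs) ys (x∉ ∷ u) = proj₁ (All.++⁻ xs x∉) ∷ Unique-prefix xs ys u

  Linked-prefix : ∀ {R : A → A → Set} (xs ys : List A) → Linked R (xs ++ ys) → Linked R xs
  Linked-prefix []           ys _       = []
  Linked-prefix (x ∷ [])     ys _       = [-]
  Linked-prefix (x ∷ y ∷ xs) ys (r ∷ l) = r ∷ Linked-prefix (y ∷ xs) ys l

  Linked-join : ∀ {R : A → A → Set} (xs : List A) z ys →
    Linked R (xs ++ [ z ]) → Linked R (z ∷ ys) → Linked R (xs ++ z ∷ ys)
  Linked-join []           z ys _        l = l
  Linked-join (x ∷ [])     z ys (r ∷ _)  l = r ∷ l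
  Linked-join (x ∷ y ∷ xs) z ys (r ∷ l₁) l = r ∷ Linked-join (y ∷ xs) z ys l₁ l

module PathsIn {n : ℕ} (T : Graph n) where

  Adj-sym : ∀ {u v} → Adj T u v → Adj T v u
  Adj-sym {u} {v} a = trans (Graph.sym T v u) a

  Adj-irrefl : ∀ {v} → ¬ Adj T v v
  Adj-irrefl {v} a = true≢false (trans (sym a) (Graph.irrefl T v))

  isInteriorEdge-intro : ∀ {a b} → a <ᶠ b → Adj T a b → isLeaf T a ≡ false → isLeaf T b ≡ false →
    isInteriorEdge T a b ≡ true
  isInteriorEdge-intro a<b a∼b la lb rewrite <?-true a<b | a∼b | la | lb = refl

  any-==⇒∈ : ∀ {v} xs → any (eqᵇ T v) xs ≡ true → v ∈ xs
  any-==⇒∈ {v} (x ∷ xs) e with v == x in v==x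
  ... | true  = here (==⇒≡ v==x)
  ... | false = there (any-==⇒∈ xs e)

  ∈⇒any-== : ∀ {v xs} → v ∈ xs → any (eqᵇ T v) xs ≡ true
  ∈⇒any-== {v} (here refl) rewrite ==-refl v = refl
  ∈⇒any-== {v} {x ∷ xs} (there v∈xs) = ∨-true⁺ʳ (v == x) (∈⇒any-== v∈xs)

  hasEdge-∷ : ∀ {u v} x xs → hasEdge T u v xs ≡ true → hasEdge T u v (x ∷ xs) ≡ true
  hasEdge-∷ {u} {v} x (y ∷ ys) h = ∨-true⁺ʳ ((x == u ∧ y == v) ∨ (x == v ∧ y == u)) h

  hasEdge-head : ∀ u v rest → hasEdge T u v (u ∷ v ∷ rest) ≡ true
  hasEdge-head u v rest rewrite ==-refl u | ==-refl v = refl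

  hasEdge-sym : ∀ u v xs → hasEdge T u v xs ≡ hasEdge T v u xs
  hasEdge-sym u v []             = refl
  hasEdge-sym u v (x ∷ [])       = refl
  hasEdge-sym u v (a ∷ b ∷ rest) = cong₂ _∨_ (∨-comm (a == u ∧ b == v) _) (hasEdge-sym u v (b ∷ rest))

  hasEdge-head′ : ∀ u v rest → hasEdge T u v (v ∷ u ∷ rest) ≡ true
  hasEdge-head′ u v rest = trans (hasEdge-sym u v (v ∷ u ∷ rest)) (hasEdge-head v u rest)

  hasEdge⇒∈ : ∀ u v xs → hasEdge T u v xs ≡ true → u ∈ xs × v ∈ xs
  hasEdge⇒∈ u v (a ∷ b ∷ rest) h =
    step (∨-true⁻ ((a == u ∧ b == v) ∨ (a == v ∧ b == u)) h) (hasEdge⇒∈ u v (b ∷ rest))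
    where
    step : ((a == u ∧ b == v) ∨ (a == v ∧ b == u)) ≡ true ⊎ hasEdge T u v (b ∷ rest) ≡ true →
           (hasEdge T u v (b ∷ rest) ≡ true → u ∈ b ∷ rest × v ∈ b ∷ rest) → u ∈ a ∷ b ∷ rest × v ∈ a ∷ b ∷ rest
    step (inj₂ h′) ih = let u∈ , v∈ = ih h′ in there u∈ , there v∈
    step (inj₁ h′) _ with ∨-true⁻ (a == u ∧ b == v) h′
    ... | inj₁ e = here (sym (==⇒≡ (∧-true⁻ˡ e))) , there (here (sym (==⇒≡ (∧-true⁻ʳ e))))
    ... | inj₂ e = there (here (sym (==⇒≡ (∧-true⁻ʳ e)))) , here (sym (==⇒≡ (∧-true⁻ˡ e)))

  containsList : List (Fin n) → Elem T → Bool
  containsList vs (vtx v)   = any (eqᵇ T v) vs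
  containsList vs (edg a b) = hasEdge T a b vs

  contains≡containsList : ∀ P e → contains T P e ≡ containsList (verts P) e
  contains≡containsList P (vtx _)   = refl
  contains≡containsList P (edg _ _) = refl

  data Position (x : Fin n) (xs : List (Fin n)) (v : Fin n) : Set where
    alone  : xs ≡ [] → x ≡ v → Position x xs v
    start  : x ≡ v → (w : Fin n) → Adj T v w → hasEdge T v w (x ∷ xs) ≡ true → Position x xs v
    end    : lastOf T x xs ≡ v → (w : Fin n) → Adj T v w → hasEdge T v w (x ∷ xs) ≡ true → Position x xs v
    inside : (w w′ : Fin n) → w ≢ w′ → Adj T v w → Adj T v w′ →
             hasEdge T v w (x ∷ xs) ≡ true → hasEdge T v w′ (x ∷ xs) ≡ true → Position x xs v

  position : ∀ x xs v → Unique (x ∷ xs) → Linked (Adj T) (x ∷ xs) → v ∈ (x ∷ xs) → Position x xs v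
  position x []       v _ _ (here refl) = alone refl refl
  position x (y ∷ ys) v _ l (here refl) = start refl y (Linked.head l) (hasEdge-head v y ys)
  position x (y ∷ ys) v (x∉ ∷ u) l (there v∈) with position y ys v u (Linked.tail l) v∈
  ... | alone refl refl = end refl x (Adj-sym (Linked.head l)) (hasEdge-head′ v x [])
  ... | start refl w a h =
    inside x w x≢w (Adj-sym (Linked.head l)) a (hasEdge-head′ v x ys) (hasEdge-∷ x (v ∷ ys) h)
    where
    x≢w : x ≢ w
    x≢w refl = Unique[x∷xs]⇒x∉xs (x∉ ∷ u) (proj₂ (hasEdge⇒∈ v x (v ∷ ys) h))
  ... | end e w a h = end e w a (hasEdge-∷ x (y ∷ ys) h)
  ... | inside w w′ w≢w′ a a′ h h′ = inside w w′ w≢w′ a a′ (hasEdge-∷ x (y ∷ ys) h) (hasEdge-∷ x (y ∷ ys) h′)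

  IsPath-prefix : ∀ x xs ys → IsPath T ((x ∷ xs) ++ ys) → IsPath T (x ∷ xs)
  IsPath-prefix x xs ys (u , l) = Unique-prefix (x ∷ xs) ys u , Linked-prefix (x ∷ xs) ys l

  IsPath-tail : ∀ {x y ys} → IsPath T (x ∷ y ∷ ys) → IsPath T (y ∷ ys)
  IsPath-tail (_ ∷ u , l) = u , Linked.tail l

  lastOf-∈ : ∀ x xs → lastOf T x xs ∈ x ∷ xs
  lastOf-∈ x []       = here refl
  lastOf-∈ x (y ∷ ys) = there (lastOf-∈ y ys)

  lastOf-snoc : ∀ x xs v → lastOf T x (xs ++ [ v ]) ≡ v
  lastOf-snoc x []       v = refl
  lastOf-snoc x (y ∷ ys) v = lastOf-snoc y ys v

module AcyclicPaths {n : ℕ} (T : Graph n) (acyclic : Acyclic T) where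
  open PathsIn T
  open DecMembership (_≟_ {n}) using (_∈?_)

  -- Walk from x along x ∷ X towards b, extending the bridge r, until the walk meets y ∷ Y;
  -- the bridge then closes a cycle.
  no-bridge : ∀ X x Y y b r →
    IsPath T (x ∷ X) → lastOf T x X ≡ b → IsPath T (y ∷ Y) → b ∈ y ∷ Y →
    Unique r → Linked (Adj T) (x ∷ r ++ [ y ]) → All (_∉ x ∷ X) r → All (_∉ y ∷ Y) r →
    1 ≤ length r → 2 ≤ length r ⊎ x ≢ y → ⊥
  no-bridge X x Y y b r px lx py b∈ ur lr dX dY r≥1 big with x ∈? (y ∷ Y)
  no-bridge X x Y y b r px lx py b∈ ur lr dX dY r≥1 big | yes x∈ with ∈-∃++ x∈
  ... | [] , post , refl = acyclic (x ∷ r) (length≥3 big , x∉r ∷ ur , lr)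
    where
    x∉r : All (x ≢_) r
    x∉r = All.map (λ z∉ x≡z → z∉ (here (sym x≡z))) dX
    length≥3 : 2 ≤ length r ⊎ x ≢ x → 3 ≤ length (x ∷ r)
    length≥3 (inj₁ r≥2) = s≤s r≥2
    length≥3 (inj₂ x≢x) = ⊥-elim (x≢x refl)
  ... | (.y ∷ pre) , post , refl = acyclic (y ∷ pre ++ x ∷ r) (length≥3 , unique , linked)
    where
    length≥3 : 3 ≤ length (y ∷ pre ++ x ∷ r)
    length≥3 = s≤s (subst (2 ≤_) (sym (length-++ pre {x ∷ r})) (≤-trans (s≤s r≥1) (m≤n+m (length (x ∷ r)) (length pre))))
    reassoc : y ∷ pre ++ x ∷ post ≡ (y ∷ pre ++ [ x ]) ++ post
    reassoc = sym (++-assoc (y ∷ pre) [ x ] post)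
    prefix : IsPath T (y ∷ pre ++ [ x ])
    prefix = IsPath-prefix y (pre ++ [ x ]) post (subst (IsPath T) reassoc py)
    unique : Unique (y ∷ pre ++ x ∷ r)
    unique = subst Unique (++-assoc (y ∷ pre) [ x ] r)
      (Unique-++ (y ∷ pre ++ [ x ]) r (proj₁ prefix) ur
        (All.map (λ {z} z∉ z∈ → z∉ (subst (z ∈_) (sym reassoc) (∈-++⁺ˡ z∈))) dY))
    linked : Linked (Adj T) (y ∷ (pre ++ x ∷ r) ++ [ y ])
    linked = subst (Linked (Adj T)) (cong (y ∷_) (sym (++-assoc pre (x ∷ r) [ y ])))
      (Linked-join (y ∷ pre) x (r ++ [ y ]) (proj₂ prefix) lr)
  no-bridge []        x Y y b r px refl py b∈ ur lr dX dY r≥1 big | no x∉ = x∉ b∈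
  no-bridge (x′ ∷ X) x Y y b r px lx py b∈ ur lr dX dY r≥1 big | no x∉ =
    no-bridge X x′ Y y b (x ∷ r) (IsPath-tail px) lx py b∈
      (All.map (λ z∉ x≡z → z∉ (here (sym x≡z))) dX ∷ ur) (Adj-sym (Linked.head (proj₂ px)) ∷ lr)
      (Unique[x∷xs]⇒x∉xs (proj₁ px) ∷ All.map (λ z∉ → z∉ ∘ there) dX) (x∉ ∷ dY) (s≤s z≤n) (inj₁ (s≤s r≥1))

  second-vertex-unique : ∀ a b x X y Y → IsPath T (a ∷ x ∷ X) → IsPath T (a ∷ y ∷ Y) →
    lastOf T x X ≡ b → lastOf T y Y ≡ b → x ≡ y
  second-vertex-unique a b x X y Y px py x⇝b y⇝b with x ≟ y
  ... | yes x≡y = x≡y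
  ... | no x≢y = ⊥-elim (no-bridge X x Y y b [ a ] (IsPath-tail px) x⇝b (IsPath-tail py)
                   (subst (_∈ y ∷ Y) y⇝b (lastOf-∈ y Y)) ([] ∷ [])
                   (Adj-sym (Linked.head (proj₂ px)) ∷ Linked.head (proj₂ py) ∷ [-])
                   (Unique[x∷xs]⇒x∉xs (proj₁ px) ∷ []) (Unique[x∷xs]⇒x∉xs (proj₁ py) ∷ []) (s≤s z≤n) (inj₂ x≢y))

module Rooted {n : ℕ} (T : Graph n) (connected : Connected T) (acyclic : Acyclic T) (root : Fin n) where
  open PathsIn T
  open AcyclicPaths T acyclic
  open DecMembership (_≟_ {n}) using (_∈?_)

  private
    second : Fin n → List (Fin n) → Fin n
    second _ (_ ∷ y ∷ _) = y
    second d _           = d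

  -- the neighbour of v on the chosen path towards the root (junk value v at the root)
  parent : Fin n → Fin n
  parent v = second v (proj₁ (connected v root))

  parent-path : ∀ v → v ≢ root → ∃ λ X → IsPath T (v ∷ parent v ∷ X) × lastOf T (parent v) X ≡ root
  parent-path v v≢root = go (proj₁ (connected v root)) (proj₂ (connected v root))
    where
    go : ∀ p → IsPathFromTo T v root p →
      ∃ λ X → IsPath T (v ∷ second v p ∷ X) × lastOf T (second v p) X ≡ root
    go (x ∷ [])     (_ , refl , x≡root) = ⊥-elim (v≢root x≡root)
    go (x ∷ y ∷ X) (path , refl , ⇝root) = X , path , ⇝root

  Adj-parent : ∀ v → v ≢ root → Adj T v (parent v)
  Adj-parent v v≢root = Linked.head (proj₂ (proj₁ (proj₂ (parent-path v v≢root))))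

  private
    edge-path : ∀ {v w} → Adj T v w → IsPath T (v ∷ w ∷ [])
    edge-path {v} a = ((λ v≡w → Adj-irrefl (subst (Adj T v) (sym v≡w) a)) ∷ []) ∷ [] ∷ [] , a ∷ [-]

  -- When neither is the root, either v lies on the root path of w, and then it is its second
  -- vertex, or v followed by the root path of w is a root path of v.
  Adj⇒parent : ∀ v w → Adj T v w → (w ≢ root × parent w ≡ v) ⊎ (v ≢ root × parent v ≡ w)
  Adj⇒parent v w a with w ≟ root | v ≟ root
  ... | yes refl | yes refl = ⊥-elim (Adj-irrefl a)
  ... | yes refl | no v≢root with parent-path v v≢root
  ...   | X , path , ⇝root = inj₂ (v≢root , second-vertex-unique v w (parent v) X w [] path (edge-path a) ⇝root refl)
  Adj⇒parent v w a | no w≢root | yes refl with parent-path w w≢root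
  ...   | X , path , ⇝root = inj₁ (w≢root , second-vertex-unique w v (parent w) X v [] path (edge-path (Adj-sym a)) ⇝root refl)
  Adj⇒parent v w a | no w≢root | no v≢root with parent-path w w≢root
  ... | Xw , path-w , w⇝root with v ∈? (w ∷ parent w ∷ Xw)
  ...   | no v∉ = inj₂ (v≢root , sym (second-vertex-unique v root w (parent w ∷ Xw) (parent v) Xv path-v-w path-v w⇝root v⇝root))
    where
    Xv = proj₁ (parent-path v v≢root)
    path-v = proj₁ (proj₂ (parent-path v v≢root))
    v⇝root = proj₂ (proj₂ (parent-path v v≢root))
    path-v-w : IsPath T (v ∷ w ∷ parent w ∷ Xw)
    path-v-w = All.tabulate (λ {z} z∈ v≡z → v∉ (subst (_∈ w ∷ parent w ∷ Xw) (sym v≡z) z∈)) ∷ proj₁ path-w , a ∷ proj₂ path-w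
  ...   | yes (here v≡w) = ⊥-elim (Adj-irrefl (subst (λ z → Adj T z w) v≡w a))
  ...   | yes (there v∈) with ∈-∃++ v∈
  ...     | [] , post , eq = inj₁ (w≢root , ∷-injectiveˡ eq)
  ...     | (p ∷ pre) , post , eq with ∷-injective eq
  ...       | refl , refl = inj₁ (w≢root ,
    second-vertex-unique w v p (pre ++ [ v ]) v [] prefix (edge-path (Adj-sym a)) (lastOf-snoc p pre v) refl)
    where
    prefix : IsPath T (w ∷ p ∷ pre ++ [ v ])
    prefix = IsPath-prefix w (p ∷ pre ++ [ v ]) post
      (subst (IsPath T) (cong (λ z → w ∷ p ∷ z) (sym (++-assoc pre [ v ] post))) path-w)

  parent-not-mutual : ∀ v w → v ≢ root → w ≢ root → parent v ≡ w → parent w ≡ v → ⊥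
  parent-not-mutual v w v≢root w≢root pv≡w pw≡v with parent-path v v≢root | parent-path w w≢root
  ... | Xv , path-v , v⇝root | Xw , path-w , w⇝root =
    go Xv (subst (λ z → IsPath T (v ∷ z ∷ Xv)) pv≡w path-v) (subst (λ z → lastOf T z Xv ≡ root) pv≡w v⇝root)
          (subst (λ z → IsPath T (w ∷ z ∷ Xw)) pw≡v path-w) (subst (λ z → lastOf T z Xw ≡ root) pw≡v w⇝root)
    where
    go : ∀ Xv → IsPath T (v ∷ w ∷ Xv) → lastOf T w Xv ≡ root → IsPath T (w ∷ v ∷ Xw) → lastOf T v Xw ≡ root → ⊥
    go []       _      w≡root _      _         = w≢root w≡root
    go (z ∷ Xv) path-v v⇝root path-w w⇝root =
      Unique[x∷xs]⇒x∉xs (proj₁ path-v) (subst (_∈ w ∷ z ∷ Xv) z≡v (there (here refl)))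
      where
      z≡v : z ≡ v
      z≡v = second-vertex-unique w root z Xv v Xw (IsPath-tail path-v) path-w v⇝root w⇝root

  isChildOf : Fin n → Fin n → Bool
  isChildOf w v = not (w == root) ∧ parent w == v

  isChildOf⇒ : ∀ {w v} → isChildOf w v ≡ true → w ≢ root × parent w ≡ v
  isChildOf⇒ e = not-==⇒≢ (∧-true⁻ˡ e) , ==⇒≡ (∧-true⁻ʳ e)

  isChildOf⇐ : ∀ {w v} → w ≢ root → parent w ≡ v → isChildOf w v ≡ true
  isChildOf⇐ {w} {v} w≢root refl rewrite ≢⇒==false w≢root | ==-refl (parent w) = refl

  private
    isChildOf⇒Adj : ∀ {w v} → isChildOf w v ≡ true → Adj T w v
    isChildOf⇒Adj e with isChildOf⇒ e
    ... | w≢root , refl = Adj-parent _ w≢root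

    ¬Adj : ∀ {v w} → adj T v w ≡ false → ¬ Adj T v w
    ¬Adj v≁w v∼w = true≢false (trans (sym v∼w) v≁w)

  𝟙-adj≡children : ∀ v w → 𝟙 (adj T v w) ≡ 𝟙 (isChildOf w v) + 𝟙 (isChildOf v w)
  𝟙-adj≡children v w with adj T v w in v∼w
  ... | true with Adj⇒parent v w v∼w
  ...   | inj₁ (w≢root , pw≡v) rewrite isChildOf⇐ w≢root pw≡v with isChildOf v w in e
  ...     | true  = ⊥-elim (parent-not-mutual v w (proj₁ (isChildOf⇒ e)) w≢root (proj₂ (isChildOf⇒ e)) pw≡v)
  ...     | false = refl
  𝟙-adj≡children v w | true | inj₂ (v≢root , pv≡w) rewrite isChildOf⇐ v≢root pv≡w with isChildOf w v in e
  ...     | true  = ⊥-elim (parent-not-mutual v w v≢root (proj₁ (isChildOf⇒ e)) pv≡w (proj₂ (isChildOf⇒ e)))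
  ...     | false = refl
  𝟙-adj≡children v w | false with isChildOf w v in e | isChildOf v w in e′
  ... | true  | _     = ⊥-elim (¬Adj v∼w (Adj-sym (isChildOf⇒Adj e)))
  ... | false | true  = ⊥-elim (¬Adj v∼w (isChildOf⇒Adj e′))
  ... | false | false = refl

  nonroots : ℕ
  nonroots = ∑[ v < n ] 𝟙 (not (v == root))

  ∑deg≡2*nonroots : ∑[ v < n ] deg T v ≡ nonroots + nonroots
  ∑deg≡2*nonroots = begin
      ∑[ v < n ] deg T v
    ≡⟨ sum-cong-≗ (λ v → trans (length-filterᵇ-allFin n (adj T v)) (sum-cong-≗ (𝟙-adj≡children v))) ⟩
      ∑[ v < n ] ∑[ w < n ] (𝟙 (isChildOf w v) + 𝟙 (isChildOf v w))
    ≡⟨ sum-cong-≗ (λ v → ∑-distrib-+ (λ w → 𝟙 (isChildOf w v)) (λ w → 𝟙 (isChildOf v w))) ⟩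
      ∑[ v < n ] (∑[ w < n ] 𝟙 (isChildOf w v) + ∑[ w < n ] 𝟙 (isChildOf v w))
    ≡⟨ ∑-distrib-+ (λ v → ∑[ w < n ] 𝟙 (isChildOf w v)) (λ v → ∑[ w < n ] 𝟙 (isChildOf v w)) ⟩
      ∑[ v < n ] ∑[ w < n ] 𝟙 (isChildOf w v) + ∑[ v < n ] ∑[ w < n ] 𝟙 (isChildOf v w)
    ≡⟨ cong (_+ ∑[ v < n ] ∑[ w < n ] 𝟙 (isChildOf v w)) (∑-comm (λ v w → 𝟙 (isChildOf w v))) ⟩
      ∑[ w < n ] ∑[ v < n ] 𝟙 (isChildOf w v) + ∑[ v < n ] ∑[ w < n ] 𝟙 (isChildOf v w)
    ≡⟨ cong₂ _+_ (sum-cong-≗ (λ w → ∑-𝟙-∧-== _ (parent w))) (sum-cong-≗ (λ v → ∑-𝟙-∧-== _ (parent v))) ⟩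
      nonroots + nonroots ∎
    where open ≡-Reasoning

  nonroots+1≡n : nonroots + 1 ≡ n
  nonroots+1≡n = begin
      nonroots + 1
    ≡⟨ cong (nonroots +_) (sym (∑-𝟙-== root)) ⟩
      nonroots + ∑[ v < n ] 𝟙 (root == v)
    ≡⟨ sym (∑-distrib-+ (λ v → 𝟙 (not (v == root))) (λ v → 𝟙 (root == v))) ⟩
      ∑[ v < n ] (𝟙 (not (v == root)) + 𝟙 (root == v))
    ≡⟨ sum-cong-≗ (λ v → trans (cong (λ b → 𝟙 (not (v == root)) + 𝟙 b) (==-sym root v)) (𝟙-not+𝟙 (v == root))) ⟩
      ∑[ v < n ] 1
    ≡⟨ ∑-one n ⟩
      n ∎
    where
    open ≡-Reasoning
    𝟙-not+𝟙 : ∀ b → 𝟙 (not b) + 𝟙 b ≡ 1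
    𝟙-not+𝟙 true  = refl
    𝟙-not+𝟙 false = refl

third-vertex : ∀ {n} → 3 ≤ n → (a b : Fin n) → ∃ λ w → a ≢ w × b ≢ w
third-vertex (s≤s (s≤s (s≤s _))) zero             zero             = suc zero , (λ ()) , (λ ())
third-vertex (s≤s (s≤s (s≤s _))) zero             (suc zero)       = suc (suc zero) , (λ ()) , (λ ())
third-vertex (s≤s (s≤s (s≤s _))) zero             (suc (suc _))    = suc zero , (λ ()) , (λ ())
third-vertex (s≤s (s≤s (s≤s _))) (suc zero)       zero             = suc (suc zero) , (λ ()) , (λ ())
third-vertex (s≤s (s≤s (s≤s _))) (suc zero)       (suc _)          = zero , (λ ()) , (λ ())
third-vertex (s≤s (s≤s (s≤s _))) (suc (suc _))    zero             = suc zero , (λ ()) , (λ ())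
third-vertex (s≤s (s≤s (s≤s _))) (suc (suc _))    (suc _)          = zero , (λ ()) , (λ ())

module CubicTree {n : ℕ} (T : Graph n) (connected : Connected T) (acyclic : Acyclic T) (n≥4 : 4 ≤ n)
                 (cubic : ∀ v → deg T v ≡ 1 ⊎ deg T v ≡ 3) where
  open PathsIn T

  deg≡∑ : ∀ v → deg T v ≡ ∑[ w < n ] 𝟙 (adj T v w)
  deg≡∑ v = length-filterᵇ-allFin n (adj T v)

  leaf⇒deg≡1 : ∀ {v} → isLeaf T v ≡ true → deg T v ≡ 1
  leaf⇒deg≡1 {v} e with deg T v ℕ.≟ 1
  ... | yes d≡1 = d≡1

  interior⇒deg≡3 : ∀ {v} → isLeaf T v ≡ false → deg T v ≡ 3
  interior⇒deg≡3 {v} e with cubic v | deg T v ℕ.≟ 1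
  ... | inj₂ d≡3 | _      = d≡3
  ... | inj₁ d≡1 | no d≢1 = ⊥-elim (d≢1 d≡1)

  leaf-neighbour : ∀ {v} → isLeaf T v ≡ true → ∃ λ w → Adj T v w × (∀ z → Adj T v z → z ≡ w)
  leaf-neighbour {v} e = count≡1⇒unique (adj T v) (trans (sym (deg≡∑ v)) (leaf⇒deg≡1 e))

  private
    attachBy : ∀ z b → isLeaf T z ≡ b → Fin n
    attachBy z true  e = proj₁ (leaf-neighbour e)
    attachBy z false _ = z

  attach : Fin n → Fin n
  attach z = attachBy z (isLeaf T z) refl

  attach-interior : ∀ {z} → isLeaf T z ≡ false → attach z ≡ z
  attach-interior {z} = go (isLeaf T z) refl
    where
    go : ∀ b (e : isLeaf T z ≡ b) → b ≡ false → attachBy z b e ≡ z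
    go false _ _ = refl

  attach-leaf : ∀ {z} → isLeaf T z ≡ true → Adj T z (attach z) × (∀ w → Adj T z w → w ≡ attach z)
  attach-leaf {z} = go (isLeaf T z) refl
    where
    go : ∀ b (e : isLeaf T z ≡ b) → b ≡ true → Adj T z (attachBy z b e) × (∀ w → Adj T z w → w ≡ attachBy z b e)
    go true e _ = proj₂ (leaf-neighbour e)

  leaf-neighbour-unique : ∀ {l y y′} → isLeaf T l ≡ true → Adj T l y → Adj T l y′ → y ≡ y′
  leaf-neighbour-unique leaf a a′ = trans (proj₂ (attach-leaf leaf) _ a) (sym (proj₂ (attach-leaf leaf) _ a′))

  -- two adjacent leaves would form a whole component, but there is a third vertex
  ¬Adj-leaf-leaf : ∀ {l l′} → isLeaf T l ≡ true → isLeaf T l′ ≡ true → ¬ Adj T l l′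
  ¬Adj-leaf-leaf {l} {l′} leaf leaf′ a with third-vertex (≤-trans (s≤s (s≤s (s≤s z≤n))) n≥4) l l′
  ... | w , l≢w , l′≢w with connected l w
  ...   | (x ∷ []) , (_ , refl , l≡w) = l≢w l≡w
  ...   | (x ∷ y ∷ []) , ((_ , ly) , refl , y≡w) = l′≢w (trans (sym (leaf-neighbour-unique leaf (Linked.head ly) a)) y≡w)
  ...   | (x ∷ y ∷ z ∷ _) , ((u , ly) , refl , _) = Unique[x∷xs]⇒x∉xs u (there (here (sym z≡l)))
    where
    l′∼z : Adj T l′ z
    l′∼z = subst (λ q → Adj T q z) (leaf-neighbour-unique leaf (Linked.head ly) a) (Linked.head (Linked.tail ly))
    z≡l : z ≡ l
    z≡l = leaf-neighbour-unique leaf′ l′∼z (Adj-sym a)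

  -- a one-vertex path counts its vertex as two endpoints
  endpointsAt : Fin n → List (Fin n) → ℕ
  endpointsAt u []       = 0
  endpointsAt u (x ∷ xs) = 𝟙 (attach x == u) + 𝟙 (attach (lastOf T x xs) == u)

  ∑endpointsAt≤2 : ∀ vs → ∑[ u < n ] endpointsAt u vs ≤ 2
  ∑endpointsAt≤2 []       = ≤-trans (≤-reflexive (∑-zero n)) z≤n
  ∑endpointsAt≤2 (x ∷ xs) = ≤-reflexive (trans
    (∑-distrib-+ (λ u → 𝟙 (attach x == u)) (λ u → 𝟙 (attach (lastOf T x xs) == u)))
    (cong₂ _+_ (∑-𝟙-== (attach x)) (∑-𝟙-== (attach (lastOf T x xs)))))

  interior : Fin n → Bool
  interior v = not (isLeaf T v)

  #leaves #interior #interiorEdges : ℕ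
  #leaves        = ∑[ v < n ] 𝟙 (isLeaf T v)
  #interior      = ∑[ v < n ] 𝟙 (interior v)
  #interiorEdges = ∑[ u < n ] ∑[ v < n ] 𝟙 (isInteriorEdge T u v)

  attachedLeaves : Fin n → ℕ
  attachedLeaves u = ∑[ l < n ] 𝟙 (isLeaf T l ∧ attach l == u)

  ∑attachedLeaves≡#leaves : ∑[ u < n ] attachedLeaves u ≡ #leaves
  ∑attachedLeaves≡#leaves =
    trans (∑-comm (λ u l → 𝟙 (isLeaf T l ∧ attach l == u))) (sum-cong-≗ (λ l → ∑-𝟙-∧-== (isLeaf T l) (attach l)))

  attachedLeaves-leaf : ∀ {u} → isLeaf T u ≡ true → attachedLeaves u ≡ 0
  attachedLeaves-leaf {u} u-leaf = trans (sum-cong-≗ none) (∑-zero n)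
    where
    none : ∀ l → 𝟙 (isLeaf T l ∧ attach l == u) ≡ 0
    none l with isLeaf T l ∧ attach l == u in e
    ... | false = refl
    ... | true  = ⊥-elim (¬Adj-leaf-leaf (∧-true⁻ˡ e) u-leaf
                    (subst (Adj T l) (==⇒≡ (∧-true⁻ʳ e)) (proj₁ (attach-leaf (∧-true⁻ˡ e)))))

  h₁≡#leaves : h₁ T ≡ #leaves
  h₁≡#leaves = length-filterᵇ-allFin n (isLeaf T)

  numInteriorEdges≡#interiorEdges : numInteriorEdges T ≡ #interiorEdges
  numInteriorEdges≡#interiorEdges =
    trans (length-concatMap-allFin n _) (sum-cong-≗ (λ u → length-filterᵇ-allFin n (isInteriorEdge T u)))

  #leaves+#interior≡n : #leaves + #interior ≡ n
  #leaves+#interior≡n =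
    trans (sym (∑-distrib-+ (𝟙 ∘ isLeaf T) (𝟙 ∘ interior))) (trans (sum-cong-≗ (𝟙+𝟙-not ∘ isLeaf T)) (∑-one n))
    where
    𝟙+𝟙-not : ∀ b → 𝟙 b + 𝟙 (not b) ≡ 1
    𝟙+𝟙-not true  = refl
    𝟙+𝟙-not false = refl

  ∑deg≡n+2*#interior : ∑[ v < n ] deg T v ≡ n + 2 * #interior
  ∑deg≡n+2*#interior =
    trans (sum-cong-≗ deg≡1+2*interior)
      (trans (∑-distrib-+ (λ _ → 1) (λ v → 2 * 𝟙 (interior v)))
        (cong₂ _+_ (∑-one n) (sym (*-distribˡ-sum 2 (𝟙 ∘ interior)))))
    where
    deg≡1+2*interior : ∀ v → deg T v ≡ 1 + 2 * 𝟙 (interior v)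
    deg≡1+2*interior v with isLeaf T v in e
    ... | true  = leaf⇒deg≡1 e
    ... | false = interior⇒deg≡3 e

  #leaves≡#interior+2 : #leaves ≡ #interior + 2
  #leaves≡#interior+2 = +-cancelʳ-≡ #interior _ _ (trans #leaves+#interior≡n (sym n≡I+2+I))
    where
    root : Fin n
    root = some-vertex n≥4
      where
      some-vertex : ∀ {m} → 4 ≤ m → Fin m
      some-vertex (s≤s _) = zero
    open Rooted T connected acyclic root using (nonroots; ∑deg≡2*nonroots; nonroots+1≡n)
    n≡I+2+I : #interior + 2 + #interior ≡ n
    n≡I+2+I = +-cancelˡ-≡ n _ _ (begin
        n + (#interior + 2 + #interior)
      ≡⟨ rearrange n #interior ⟩
        n + 2 * #interior + 2
      ≡⟨ cong (_+ 2) (trans (sym ∑deg≡n+2*#interior) ∑deg≡2*nonroots) ⟩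
        nonroots + nonroots + 2
      ≡⟨ rearrange′ nonroots ⟩
        (nonroots + 1) + (nonroots + 1)
      ≡⟨ cong₂ _+_ nonroots+1≡n nonroots+1≡n ⟩
        n + n ∎)
      where
      open ≡-Reasoning
      rearrange : ∀ n I → n + (I + 2 + I) ≡ n + 2 * I + 2
      rearrange = solve-∀
      rearrange′ : ∀ N → N + N + 2 ≡ (N + 1) + (N + 1)
      rearrange′ = solve-∀

  private
    interiorAdj : Fin n → Fin n → Bool
    interiorAdj u v = adj T u v ∧ (interior u ∧ interior v)

    isInteriorEdge≡ : ∀ u v → isInteriorEdge T u v ≡ ⌊ u <? v ⌋ ∧ interiorAdj u v
    isInteriorEdge≡ u v = cong₂ (λ x y → ⌊ u <? v ⌋ ∧ adj T u v ∧ x ∧ y) (not≡ (isLeaf T u)) (not≡ (isLeaf T v))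
      where
      not≡ : ∀ b → Defs.not T b ≡ not b
      not≡ true  = refl
      not≡ false = refl

    -- an unordered interior edge {u,v} is counted once, at (min, max)
    𝟙-interiorAdj≡ : ∀ u v → 𝟙 (interiorAdj u v) ≡ 𝟙 (isInteriorEdge T u v) + 𝟙 (isInteriorEdge T v u)
    𝟙-interiorAdj≡ u v rewrite isInteriorEdge≡ u v | isInteriorEdge≡ v u with <-cmp u v
    ... | tri< u<v _ v≮u rewrite <?-true u<v | <?-false v≮u = sym (+-identityʳ _)
    ... | tri≈ u≮u refl _ rewrite <?-false u≮u | Graph.irrefl T u = refl
    ... | tri> u≮v _ v<u rewrite <?-false u≮v | <?-true v<u =
      cong 𝟙 (cong₂ _∧_ (Graph.sym T u v) (∧-comm (interior u) (interior v)))

    ∑interiorAdj≡2*#interiorEdges : ∑[ u < n ] ∑[ v < n ] 𝟙 (interiorAdj u v) ≡ #interiorEdges + #interiorEdges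
    ∑interiorAdj≡2*#interiorEdges =
      trans (sum-cong-≗ (λ u → trans (sum-cong-≗ (𝟙-interiorAdj≡ u))
                                      (∑-distrib-+ (λ v → 𝟙 (isInteriorEdge T u v)) (λ v → 𝟙 (isInteriorEdge T v u)))))
        (trans (∑-distrib-+ (λ u → ∑[ v < n ] 𝟙 (isInteriorEdge T u v)) (λ u → ∑[ v < n ] 𝟙 (isInteriorEdge T v u)))
          (cong (#interiorEdges +_) (∑-comm (λ u v → 𝟙 (isInteriorEdge T v u)))))

    ∑adj∧interior≡3*interior : ∀ u → ∑[ v < n ] 𝟙 (adj T u v ∧ interior u) ≡ 3 * 𝟙 (interior u)
    ∑adj∧interior≡3*interior u with isLeaf T u in e
    ... | true  = trans (sum-cong-≗ (λ v → cong 𝟙 (∧-zeroʳ (adj T u v)))) (∑-zero n)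
    ... | false = trans (sum-cong-≗ (λ v → cong 𝟙 (∧-identityʳ (adj T u v)))) (trans (sym (deg≡∑ u)) (interior⇒deg≡3 e))

    -- a leaf has exactly one neighbour, and it is interior
    ∑adj∧interior∧leaf≡leaf : ∀ v → ∑[ u < n ] 𝟙 (adj T u v ∧ interior u ∧ isLeaf T v) ≡ 𝟙 (isLeaf T v)
    ∑adj∧interior∧leaf≡leaf v with isLeaf T v in e
    ... | false = trans (sum-cong-≗ (λ u → cong 𝟙 (trans (cong (adj T u v ∧_) (∧-zeroʳ (interior u))) (∧-zeroʳ (adj T u v)))))
                        (∑-zero n)
    ... | true  = trans (sum-cong-≗ term≡) (trans (sym (deg≡∑ v)) (leaf⇒deg≡1 e))
      where
      term≡ : ∀ u → 𝟙 (adj T u v ∧ interior u ∧ true) ≡ 𝟙 (adj T v u)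
      term≡ u with adj T u v in u∼v
      ... | false = cong 𝟙 (sym (trans (Graph.sym T v u) u∼v))
      ... | true with isLeaf T u in u-leaf
      ...   | true  = ⊥-elim (¬Adj-leaf-leaf e u-leaf (Adj-sym u∼v))
      ...   | false = cong 𝟙 (sym (trans (Graph.sym T v u) u∼v))

    split : ∀ a x y → 𝟙 (a ∧ x) ≡ 𝟙 (a ∧ (x ∧ not y)) + 𝟙 (a ∧ x ∧ y)
    split true  true  true  = refl
    split true  true  false = refl
    split true  false y     = refl
    split false x     y     = refl

  3*#interior≡2*#interiorEdges+#leaves : 3 * #interior ≡ (#interiorEdges + #interiorEdges) + #leaves
  3*#interior≡2*#interiorEdges+#leaves = begin
      3 * #interior
    ≡⟨ *-distribˡ-sum 3 (𝟙 ∘ interior) ⟩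
      ∑[ u < n ] (3 * 𝟙 (interior u))
    ≡⟨ sym (sum-cong-≗ ∑adj∧interior≡3*interior) ⟩
      ∑[ u < n ] ∑[ v < n ] 𝟙 (adj T u v ∧ interior u)
    ≡⟨ sum-cong-≗ (λ u → trans (sum-cong-≗ (λ v → split (adj T u v) (interior u) (isLeaf T v)))
                               (∑-distrib-+ (𝟙 ∘ interiorAdj u) (λ v → 𝟙 (adj T u v ∧ interior u ∧ isLeaf T v)))) ⟩
      ∑[ u < n ] (∑[ v < n ] 𝟙 (interiorAdj u v) + ∑[ v < n ] 𝟙 (adj T u v ∧ interior u ∧ isLeaf T v))
    ≡⟨ ∑-distrib-+ (λ u → ∑[ v < n ] 𝟙 (interiorAdj u v)) (λ u → ∑[ v < n ] 𝟙 (adj T u v ∧ interior u ∧ isLeaf T v)) ⟩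
      ∑[ u < n ] ∑[ v < n ] 𝟙 (interiorAdj u v) + ∑[ u < n ] ∑[ v < n ] 𝟙 (adj T u v ∧ interior u ∧ isLeaf T v)
    ≡⟨ cong₂ _+_ ∑interiorAdj≡2*#interiorEdges
                 (trans (∑-comm (λ u v → 𝟙 (adj T u v ∧ interior u ∧ isLeaf T v))) (sum-cong-≗ ∑adj∧interior∧leaf≡leaf)) ⟩
      (#interiorEdges + #interiorEdges) + #leaves ∎
    where open ≡-Reasoning

  #leaves≡#interiorEdges+3 : #leaves ≡ #interiorEdges + 3
  #leaves≡#interiorEdges+3 = trans #leaves≡#interior+2 (trans (cong (_+ 2) I≡E+1) (+-assoc E 1 2))
    where
    L = #leaves; I = #interior; E = #interiorEdges
    I≡E+1 : I ≡ E + 1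
    I≡E+1 = *-cancelˡ-≡ I (E + 1) 2 (+-cancelʳ-≡ I _ _ (begin
        2 * I + I            ≡⟨ 2I+I≡3I I ⟩
        3 * I                ≡⟨ 3*#interior≡2*#interiorEdges+#leaves ⟩
        (E + E) + L          ≡⟨ cong ((E + E) +_) #leaves≡#interior+2 ⟩
        (E + E) + (I + 2)    ≡⟨ rearrange E I ⟩
        2 * (E + 1) + I      ∎))
      where
      open ≡-Reasoning
      2I+I≡3I : ∀ I → 2 * I + I ≡ 3 * I
      2I+I≡3I = solve-∀
      rearrange : ∀ E I → (E + E) + (I + 2) ≡ 2 * (E + 1) + I
      rearrange = solve-∀

triple : {A : Set} → A → A → A → Fin 3 → A
triple a b c zero             = a
triple a b c (suc zero)       = b
triple a b c (suc (suc zero)) = c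

triple-η : {A : Set} (f : Fin 3 → A) → ∀ y → triple (f zero) (f (suc zero)) (f (suc (suc zero))) y ≡ f y
triple-η f zero             = refl
triple-η f (suc zero)       = refl
triple-η f (suc (suc zero)) = refl

-- which of the three neighbours of an interior vertex u are leaves
LeafPattern : Set
LeafPattern = Fin 3 → Bool

-- How a path meets u and its neighbours w₀ w₁ w₂: through u, using exactly the edges u w_y with
-- e_y set, or as the one-vertex path w_y; a path meeting none of them has no type.
data LocalType : Set where
  through  : (e₀ e₁ e₂ : Bool) → LocalType
  leafOnly : Fin 3 → LocalType

allTypes : Vec LocalType 11
allTypes =
  through false false false ∷ through true false false ∷ through false true false ∷ through false false true ∷
  through true true false ∷ through true false true ∷ through false true true ∷ through true true true ∷
  leafOnly zero ∷ leafOnly (suc zero) ∷ leafOnly (suc (suc zero)) ∷ []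

indexOf : LocalType → Fin 11
indexOf (through false false false) = zero
indexOf (through true  false false) = suc zero
indexOf (through false true  false) = suc (suc zero)
indexOf (through false false true ) = suc (suc (suc zero))
indexOf (through true  true  false) = suc (suc (suc (suc zero)))
indexOf (through true  false true ) = suc (suc (suc (suc (suc zero))))
indexOf (through false true  true ) = suc (suc (suc (suc (suc (suc zero)))))
indexOf (through true  true  true ) = suc (suc (suc (suc (suc (suc (suc zero))))))
indexOf (leafOnly zero)             = suc (suc (suc (suc (suc (suc (suc (suc zero)))))))
indexOf (leafOnly (suc zero))       = suc (suc (suc (suc (suc (suc (suc (suc (suc zero))))))))
indexOf (leafOnly (suc (suc zero))) = suc (suc (suc (suc (suc (suc (suc (suc (suc (suc zero)))))))))

lookup-indexOf : ∀ t → lookup allTypes (indexOf t) ≡ t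
lookup-indexOf (through false false false) = refl
lookup-indexOf (through true  false false) = refl
lookup-indexOf (through false true  false) = refl
lookup-indexOf (through false false true ) = refl
lookup-indexOf (through true  true  false) = refl
lookup-indexOf (through true  false true ) = refl
lookup-indexOf (through false true  true ) = refl
lookup-indexOf (through true  true  true ) = refl
lookup-indexOf (leafOnly zero)             = refl
lookup-indexOf (leafOnly (suc zero))       = refl
lookup-indexOf (leafOnly (suc (suc zero))) = refl


-- The four local elements at u, indexed by Fin 4: index 0 is u itself, index 1 + y is the
-- neighbour w_y if it is a leaf and the edge u w_y otherwise.
localContains : LeafPattern → LocalType → Fin 4 → Bool
localContains p (through e₀ e₁ e₂) zero    = true
localContains p (through e₀ e₁ e₂) (suc y) = triple e₀ e₁ e₂ y
localContains p (leafOnly y)       zero    = false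
localContains p (leafOnly y)       (suc z) = z == y ∧ p y

-- a lower bound on the endpoints of the path among u and its leaves: u is an endpoint 2 ∸ d times
-- when the path uses d edges at u, and a leaf entered from u is an endpoint
localWeight : LeafPattern → LocalType → ℕ
localWeight p (through e₀ e₁ e₂) =
  (2 ∸ ∑[ y < 3 ] 𝟙 (triple e₀ e₁ e₂ y)) + ∑[ y < 3 ] 𝟙 (p y ∧ triple e₀ e₁ e₂ y)
localWeight p (leafOnly y) = 2

#leavesIn : LeafPattern → ℕ
#leavesIn p = ∑[ y < 3 ] 𝟙 (p y)

s₀ s₁ s₂ s₃ : Fin 4
s₀ = zero
s₁ = suc zero
s₂ = suc (suc zero)
s₃ = suc (suc (suc zero))

someType : ∀ {m} → (LocalType → Bool) → Vec Bool m → Vec LocalType m → Bool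
someType Q []      []       = false
someType Q (a ∷ A) (t ∷ ts) = (a ∧ Q t) ∨ someType Q A ts

module _ (p : LeafPattern) where

  weightOf : ∀ {m} → Vec Bool m → Vec LocalType m → ℕ
  weightOf []      []       = 0
  weightOf (a ∷ A) (t ∷ ts) = (if a then localWeight p t else 0) + weightOf A ts

  covered : Vec Bool 11 → Fin 4 → Bool
  covered A s = someType (λ t → localContains p t s) A allTypes
  separated : Vec Bool 11 → Fin 4 → Fin 4 → Bool
  separated A s s′ = someType (λ t → localContains p t s xor localContains p t s′) A allTypes

  separatesCovers : Vec Bool 11 → Bool
  separatesCovers A =
    covered A s₀ ∧ covered A s₁ ∧ covered A s₂ ∧ covered A s₃ ∧
    separated A s₀ s₁ ∧ separated A s₀ s₂ ∧ separated A s₀ s₃ ∧ separated A s₁ s₂ ∧ separated A s₁ s₃ ∧ separated A s₂ s₃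

  satisfiesBound : Vec Bool 11 → Bool
  satisfiesBound A = not (separatesCovers A) ∨ (2 * #leavesIn p ≤ᵇ weightOf A allTypes)

forAllSubsets : (m : ℕ) → (Vec Bool m → Bool) → Bool
forAllSubsets zero    P = P []
forAllSubsets (suc m) P = forAllSubsets m (P ∘ (true ∷_)) ∧ forAllSubsets m (P ∘ (false ∷_))

forAllSubsets-sound : ∀ m P → forAllSubsets m P ≡ true → ∀ A → P A ≡ true
forAllSubsets-sound zero    P e []          = e
forAllSubsets-sound (suc m) P e (true ∷ A)  = forAllSubsets-sound m _ (∧-true⁻ˡ e) A
forAllSubsets-sound (suc m) P e (false ∷ A) = forAllSubsets-sound m _ (∧-true⁻ʳ e) A

all-local-configurations : ∀ a b c → forAllSubsets 11 (satisfiesBound (triple a b c)) ≡ true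
all-local-configurations false false false = refl
all-local-configurations false false true  = refl
all-local-configurations false true  false = refl
all-local-configurations false true  true  = refl
all-local-configurations true  false false = refl
all-local-configurations true  false true  = refl
all-local-configurations true  true  false = refl
all-local-configurations true  true  true  = refl

maybeContains : LeafPattern → Maybe LocalType → Fin 4 → Bool
maybeContains p nothing  s = false
maybeContains p (just t) s = localContains p t s

maybeWeight : LeafPattern → Maybe LocalType → ℕ
maybeWeight p nothing  = 0
maybeWeight p (just t) = localWeight p t

include : Maybe LocalType → Vec Bool 11 → Vec Bool 11
include nothing  A = A
include (just t) A = A [ indexOf t ]≔ true

support : ∀ k → (Fin k → Maybe LocalType) → Vec Bool 11
support zero    τ = replicate 11 false
support (suc k) τ = include (τ zero) (support k (τ ∘ suc))

module _ (p : LeafPattern) where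

  weightOf-update : ∀ {m} (j : Fin m) A ts → weightOf p (A [ j ]≔ true) ts ≤ localWeight p (lookup ts j) + weightOf p A ts
  weightOf-update zero    (a ∷ A) (t ∷ ts) = +-monoʳ-≤ (localWeight p t) (m≤n+m _ _)
  weightOf-update (suc j) (a ∷ A) (t ∷ ts) =
    ≤-trans (+-monoʳ-≤ (if a then localWeight p t else 0) (weightOf-update j A ts))
      (≤-reflexive (trans (sym (+-assoc x y z)) (trans (cong (_+ z) (+-comm x y)) (+-assoc y x z))))
    where
    x = if a then localWeight p t else 0
    y = localWeight p (lookup ts j)
    z = weightOf p A ts

  weightOf-include : ∀ m A → weightOf p (include m A) allTypes ≤ maybeWeight p m + weightOf p A allTypes
  weightOf-include nothing  A = ≤-refl
  weightOf-include (just t) A =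
    subst (λ t′ → weightOf p (A [ indexOf t ]≔ true) allTypes ≤ localWeight p t′ + weightOf p A allTypes)
      (lookup-indexOf t) (weightOf-update (indexOf t) A allTypes)

  weightOf-empty : ∀ {m} (ts : Vec LocalType m) → weightOf p (replicate m false) ts ≡ 0
  weightOf-empty []       = refl
  weightOf-empty (t ∷ ts) = weightOf-empty ts

  weightOf-support : ∀ k τ → weightOf p (support k τ) allTypes ≤ ∑[ i < k ] maybeWeight p (τ i)
  weightOf-support zero    τ = ≤-reflexive (weightOf-empty allTypes)
  weightOf-support (suc k) τ =
    ≤-trans (weightOf-include (τ zero) _) (+-monoʳ-≤ (maybeWeight p (τ zero)) (weightOf-support k (τ ∘ suc)))

lookup-update-mono : ∀ {m} (j j′ : Fin m) A → lookup A j′ ≡ true → lookup (A [ j ]≔ true) j′ ≡ true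
lookup-update-mono j j′ A e with j ≟ j′
... | yes refl = lookup∘update j A true
... | no j≢j′  = trans (lookup∘update′ (j≢j′ ∘ sym) A true) e

lookup-include-mono : ∀ m j A → lookup A j ≡ true → lookup (include m A) j ≡ true
lookup-include-mono nothing  j A e = e
lookup-include-mono (just t) j A e = lookup-update-mono (indexOf t) j A e

lookup-support : ∀ k τ i t → τ i ≡ just t → lookup (support k τ) (indexOf t) ≡ true
lookup-support (suc k) τ zero    t e rewrite e = lookup∘update (indexOf t) (support k (τ ∘ suc)) true
lookup-support (suc k) τ (suc i) t e = lookup-include-mono (τ zero) (indexOf t) _ (lookup-support k (τ ∘ suc) i t e)

someType-intro : ∀ {m} Q (A : Vec Bool m) ts j → lookup A j ≡ true → Q (lookup ts j) ≡ true → someType Q A ts ≡ true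
someType-intro Q (a ∷ A) (t ∷ ts) zero    e q rewrite e | q = refl
someType-intro Q (a ∷ A) (t ∷ ts) (suc j) e q with a ∧ Q t
... | true  = refl
... | false = someType-intro Q A ts j e q

someType-support : ∀ k τ Q i t → τ i ≡ just t → Q t ≡ true → someType Q (support k τ) allTypes ≡ true
someType-support k τ Q i t e q =
  someType-intro Q (support k τ) allTypes (indexOf t) (lookup-support k τ i t e)
    (subst (λ t′ → Q t′ ≡ true) (sym (lookup-indexOf t)) q)

-- Weights are nonnegative, so the set of types occurring in the family already has weight at most
-- the family's total, and that set is one of the configurations checked above.
local-bound : ∀ a b c k (τ : Fin k → Maybe LocalType) → let p = triple a b c in
  (∀ s s′ → s ≢ s′ → ∃ λ i → maybeContains p (τ i) s ≢ maybeContains p (τ i) s′) →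
  (∀ s → ∃ λ i → maybeContains p (τ i) s ≡ true) →
  2 * #leavesIn p ≤ ∑[ i < k ] maybeWeight p (τ i)
local-bound a b c k τ separates covers =
  ≤-trans (bound A (check A) conditions) (weightOf-support p k τ)
  where
  p = triple a b c
  A = support k τ
  bound : ∀ A → satisfiesBound p A ≡ true → separatesCovers p A ≡ true → 2 * #leavesIn p ≤ weightOf p A allTypes
  bound A ok sc rewrite sc = ≤ᵇ⇒≤ (2 * #leavesIn p) (weightOf p A allTypes) (subst T (sym ok) _)
  check : ∀ A → satisfiesBound p A ≡ true
  check = forAllSubsets-sound 11 (satisfiesBound p) (all-local-configurations a b c)
  covered-A : ∀ s → covered p A s ≡ true
  covered-A s with covers s
  ... | i , e with τ i in τi
  ...   | just t = someType-support k τ _ i t τi e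
  separated-A : ∀ s s′ → s ≢ s′ → separated p A s s′ ≡ true
  separated-A s s′ s≢s′ with separates s s′ s≢s′
  ... | i , d with τ i in τi
  ...   | nothing = ⊥-elim (d refl)
  ...   | just t  = someType-support k τ _ i t τi (xor-≢ d)
    where
    xor-≢ : ∀ {a b} → a ≢ b → a xor b ≡ true
    xor-≢ {true}  {true}  a≢b = ⊥-elim (a≢b refl)
    xor-≢ {true}  {false} _   = refl
    xor-≢ {false} {true}  _   = refl
    xor-≢ {false} {false} a≢b = ⊥-elim (a≢b refl)
  conditions : separatesCovers p A ≡ true
  conditions =
    ∧-true⁺ (covered-A s₀) (∧-true⁺ (covered-A s₁) (∧-true⁺ (covered-A s₂) (∧-true⁺ (covered-A s₃)
    (∧-true⁺ (separated-A s₀ s₁ (λ ())) (∧-true⁺ (separated-A s₀ s₂ (λ ())) (∧-true⁺ (separated-A s₀ s₃ (λ ()))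
    (∧-true⁺ (separated-A s₁ s₂ (λ ())) (∧-true⁺ (separated-A s₁ s₃ (λ ())) (separated-A s₂ s₃ (λ ()))))))))))

module LocalBound {n : ℕ} (T : Graph n) (connected : Connected T) (acyclic : Acyclic T) (n≥4 : 4 ≤ n)
                  (cubic : ∀ v → deg T v ≡ 1 ⊎ deg T v ≡ 3)
                  (u : Fin n) (u-interior : isLeaf T u ≡ false) (w : Fin 3 → Fin n)
                  (Adj-w : ∀ y → Adj T u (w y)) (w-injective : ∀ y y′ → w y ≡ w y′ → y ≡ y′)
                  (w-onto : ∀ z → Adj T u z → ∃ λ y → z ≡ w y) where
  open PathsIn T
  open CubicTree T connected acyclic n≥4 cubic

  u≢w : ∀ y → u ≢ w y
  u≢w y u≡w = Adj-irrefl (subst (Adj T u) (sym u≡w) (Adj-w y))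

  leafAtW : Fin 3 → Bool
  leafAtW y = isLeaf T (w y)

  leafPattern : LeafPattern
  leafPattern = triple (leafAtW zero) (leafAtW (suc zero)) (leafAtW (suc (suc zero)))

  leaf-neighbour≡u : ∀ {y z} → leafAtW y ≡ true → Adj T (w y) z → z ≡ u
  leaf-neighbour≡u leaf a = trans (proj₂ (attach-leaf leaf) _ a) (sym (proj₂ (attach-leaf leaf) _ (Adj-sym (Adj-w _))))

  attach-w : ∀ {y} → leafAtW y ≡ true → attach (w y) ≡ u
  attach-w leaf = leaf-neighbour≡u leaf (proj₁ (attach-leaf leaf))

  hasU : List (Fin n) → Bool
  hasU = any (eqᵇ T u)

  hasW : Fin 3 → List (Fin n) → Bool
  hasW y = any (eqᵇ T (w y))

  usesEdge : Fin 3 → List (Fin n) → Bool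
  usesEdge y = hasEdge T u (w y)

  usesEdge⇒ : ∀ y vs → usesEdge y vs ≡ true → hasW y vs ≡ true × hasU vs ≡ true
  usesEdge⇒ y vs e = let u∈ , w∈ = hasEdge⇒∈ u (w y) vs e in ∈⇒any-== w∈ , ∈⇒any-== u∈

  usesEdge-false : ∀ y vs → hasU vs ≡ false → usesEdge y vs ≡ false
  usesEdge-false y vs ¬u with usesEdge y vs in e
  ... | false = refl
  ... | true  = ⊥-elim (true≢false (trans (sym (proj₂ (usesEdge⇒ y vs e))) ¬u))

  private
    two-neighbours : ∀ {y z z′} → leafAtW y ≡ true → z ≢ z′ → ¬ (Adj T (w y) z × Adj T (w y) z′)
    two-neighbours leaf z≢z′ (a , a′) = z≢z′ (trans (leaf-neighbour≡u leaf a) (sym (leaf-neighbour≡u leaf a′)))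

    leaf-edge⇒usesEdge : ∀ {y z} vs → leafAtW y ≡ true → Adj T (w y) z → hasEdge T (w y) z vs ≡ true → usesEdge y vs ≡ true
    leaf-edge⇒usesEdge {y} vs leaf a h =
      trans (hasEdge-sym u (w y) vs) (subst (λ z → hasEdge T (w y) z vs ≡ true) (leaf-neighbour≡u leaf a) h)

  leaf-on-path : ∀ x xs y → IsPath T (x ∷ xs) → leafAtW y ≡ true → hasW y (x ∷ xs) ≡ true →
    (xs ≡ [] × x ≡ w y) ⊎ usesEdge y (x ∷ xs) ≡ true
  leaf-on-path x xs y (uniq , linked) leaf w∈ with position x xs (w y) uniq linked (any-==⇒∈ (x ∷ xs) w∈)
  ... | alone xs≡[] x≡w = inj₁ (xs≡[] , x≡w)
  ... | start _ z a h = inj₂ (leaf-edge⇒usesEdge (x ∷ xs) leaf a h)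
  ... | end _ z a h   = inj₂ (leaf-edge⇒usesEdge (x ∷ xs) leaf a h)
  ... | inside z z′ z≢z′ a a′ _ _ = ⊥-elim (two-neighbours leaf z≢z′ (a , a′))

  leaf-on-path⇒endpoint : ∀ x xs y → IsPath T (x ∷ xs) → leafAtW y ≡ true → hasW y (x ∷ xs) ≡ true →
    1 ≤ 𝟙 (x == w y) + 𝟙 (lastOf T x xs == w y)
  leaf-on-path⇒endpoint x xs y (uniq , linked) leaf w∈ with position x xs (w y) uniq linked (any-==⇒∈ (x ∷ xs) w∈)
  ... | alone _ x≡w rewrite x≡w | ==-refl (w y) = s≤s z≤n
  ... | start x≡w _ _ _ rewrite x≡w | ==-refl (w y) = s≤s z≤n
  ... | end last≡w _ _ _ rewrite last≡w | ==-refl (w y) = m≤n+m 1 _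
  ... | inside z z′ z≢z′ a a′ _ _ = ⊥-elim (two-neighbours leaf z≢z′ (a , a′))

  -- a path through u either ends at u or leaves it along an edge, on each of its two sides
  u-on-path⇒ends+edges≥2 : ∀ x xs → IsPath T (x ∷ xs) → hasU (x ∷ xs) ≡ true →
    2 ≤ (𝟙 (x == u) + 𝟙 (lastOf T x xs == u)) + ∑[ y < 3 ] 𝟙 (usesEdge y (x ∷ xs))
  u-on-path⇒ends+edges≥2 x xs (uniq , linked) u∈ with position x xs u uniq linked (any-==⇒∈ (x ∷ xs) u∈)
  ... | alone refl refl rewrite ==-refl x = s≤s (s≤s z≤n)
  ... | start x≡u z a h with w-onto z a
  ...   | y , refl rewrite x≡u | ==-refl u =
    +-mono-≤ (m≤m+n 1 (𝟙 (lastOf T u xs == u))) (true⇒1≤∑𝟙 (λ y → usesEdge y (u ∷ xs)) y h)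
  u-on-path⇒ends+edges≥2 x xs _ _ | end last≡u z a h with w-onto z a
  ...   | y , refl rewrite last≡u | ==-refl u =
    +-mono-≤ (m≤n+m 1 (𝟙 (x == u))) (true⇒1≤∑𝟙 (λ y → usesEdge y (x ∷ xs)) y h)
  u-on-path⇒ends+edges≥2 x xs _ _ | inside z z′ z≢z′ a a′ h h′ with w-onto z a | w-onto z′ a′
  ...   | y , refl | y′ , refl =
    ≤-trans (true²⇒2≤∑𝟙 (λ y → usesEdge y (x ∷ xs)) y y′ (z≢z′ ∘ cong w) h h′) (m≤n+m _ (𝟙 (x == u) + 𝟙 (lastOf T x xs == u)))

  -- z is u, or a leaf neighbour of u (for at most one y), or neither
  leaves-attached-at : ∀ z → 𝟙 (z == u) + ∑[ y < 3 ] 𝟙 (leafAtW y ∧ z == w y) ≤ 𝟙 (attach z == u)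
  leaves-attached-at z with z ≟ u
  ... | yes refl rewrite attach-interior u-interior | ==-refl u =
    s≤s (≤-reflexive (trans (sum-cong-≗ (λ y → cong (λ b → 𝟙 (leafAtW y ∧ b)) (≢⇒==false (u≢w y)))) ∑-zero′))
    where
    ∑-zero′ : ∑[ y < 3 ] 𝟙 (leafAtW y ∧ false) ≡ 0
    ∑-zero′ = trans (sum-cong-≗ (λ y → cong 𝟙 (∧-zeroʳ (leafAtW y)))) (∑-zero 3)
  ... | no z≢u with any? (λ y → leafAtW y ∧ z == w y Bool.≟ true)
  ...   | no none = ≤-trans (≤-reflexive (trans (sum-cong-≗ (λ y → ≢true⇒𝟙≡0 (λ e → none (y , e)))) (∑-zero 3))) z≤n
  ...   | yes (y , e) =
    ≤-trans (∑𝟙≤1 (λ i → leafAtW i ∧ z == w i) at-most-one) (≤-reflexive (sym (cong 𝟙 attach-z==u)))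
    where
    attach-z==u : attach z == u ≡ true
    attach-z==u = subst (λ v → v == u ≡ true) (sym (trans (cong attach (==⇒≡ (∧-true⁻ʳ e))) (attach-w (∧-true⁻ˡ e)))) (==-refl u)
    at-most-one : ∀ i j → leafAtW i ∧ z == w i ≡ true → leafAtW j ∧ z == w j ≡ true → i ≡ j
    at-most-one i j ei ej = w-injective i j (trans (sym (==⇒≡ (∧-true⁻ʳ {leafAtW i} ei))) (==⇒≡ (∧-true⁻ʳ {leafAtW j} ej)))

  leaf-edge≤ends : ∀ x xs → IsPath T (x ∷ xs) → ∀ y →
    𝟙 (leafAtW y ∧ usesEdge y (x ∷ xs)) ≤ 𝟙 (leafAtW y ∧ x == w y) + 𝟙 (leafAtW y ∧ lastOf T x xs == w y)
  leaf-edge≤ends x xs path y with leafAtW y in leaf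
  ... | false = z≤n
  ... | true with usesEdge y (x ∷ xs) in e
  ...   | false = z≤n
  ...   | true  = leaf-on-path⇒endpoint x xs y path leaf (proj₁ (usesEdge⇒ y (x ∷ xs) e))

  throughType : List (Fin n) → LocalType
  throughType vs = through (usesEdge zero vs) (usesEdge (suc zero) vs) (usesEdge (suc (suc zero)) vs)

  weight-through : ∀ x xs → IsPath T (x ∷ xs) → hasU (x ∷ xs) ≡ true →
    localWeight leafPattern (throughType (x ∷ xs)) ≤ endpointsAt u (x ∷ xs)
  weight-through x xs path u∈ = begin
      (2 ∸ ∑[ y < 3 ] 𝟙 (triple e₀ e₁ e₂ y)) + ∑[ y < 3 ] 𝟙 (leafPattern y ∧ triple e₀ e₁ e₂ y)
    ≡⟨ cong₂ (λ a b → (2 ∸ a) + b) (sum-cong-≗ (cong 𝟙 ∘ triple-η uses))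
                                   (sum-cong-≗ (λ y → cong₂ (λ a b → 𝟙 (a ∧ b)) (triple-η leafAtW y) (triple-η uses y))) ⟩
      (2 ∸ ∑[ y < 3 ] 𝟙 (uses y)) + ∑[ y < 3 ] 𝟙 (leafAtW y ∧ uses y)
    ≤⟨ +-mono-≤ ends≥ (∑-mono-≤ (leaf-edge≤ends x xs path)) ⟩
      (𝟙 (x == u) + 𝟙 (l == u)) + ∑[ y < 3 ] (𝟙 (leafAtW y ∧ x == w y) + 𝟙 (leafAtW y ∧ l == w y))
    ≡⟨ cong ((𝟙 (x == u) + 𝟙 (l == u)) +_) (∑-distrib-+ (λ y → 𝟙 (leafAtW y ∧ x == w y)) (λ y → 𝟙 (leafAtW y ∧ l == w y))) ⟩
      (𝟙 (x == u) + 𝟙 (l == u)) + (∑[ y < 3 ] 𝟙 (leafAtW y ∧ x == w y) + ∑[ y < 3 ] 𝟙 (leafAtW y ∧ l == w y))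
    ≡⟨ interchange (𝟙 (x == u)) (𝟙 (l == u)) _ _ ⟩
      (𝟙 (x == u) + ∑[ y < 3 ] 𝟙 (leafAtW y ∧ x == w y)) + (𝟙 (l == u) + ∑[ y < 3 ] 𝟙 (leafAtW y ∧ l == w y))
    ≤⟨ +-mono-≤ (leaves-attached-at x) (leaves-attached-at l) ⟩
      endpointsAt u (x ∷ xs) ∎
    where
    open ≤-Reasoning
    uses : Fin 3 → Bool
    uses y = usesEdge y (x ∷ xs)
    e₀ = uses zero; e₁ = uses (suc zero); e₂ = uses (suc (suc zero))
    l = lastOf T x xs
    ends≥ : 2 ∸ ∑[ y < 3 ] 𝟙 (uses y) ≤ 𝟙 (x == u) + 𝟙 (l == u)
    ends≥ = ≤-trans (∸-monoˡ-≤ (∑[ y < 3 ] 𝟙 (uses y)) (u-on-path⇒ends+edges≥2 x xs path u∈))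
                    (≤-reflexive (m+n∸n≡m (𝟙 (x == u) + 𝟙 (l == u)) (∑[ y < 3 ] 𝟙 (uses y))))
    interchange : ∀ a b c d → (a + b) + (c + d) ≡ (a + c) + (b + d)
    interchange = solve-∀

  data LocalView (vs : List (Fin n)) : Set where
    viaU     : hasU vs ≡ true → LocalView vs
    leafPath : ∀ y → leafAtW y ≡ true → vs ≡ w y ∷ [] → LocalView vs
    away     : hasU vs ≡ false → (∀ y → leafAtW y ≡ true → hasW y vs ≡ false) → LocalView vs

  leaf-path-avoiding-u : ∀ vs y → IsPath T vs → leafAtW y ≡ true → hasW y vs ≡ true → hasU vs ≡ false → vs ≡ w y ∷ []
  leaf-path-avoiding-u (x ∷ xs) y path leaf w∈ u∉ with leaf-on-path x xs y path leaf w∈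
  ... | inj₁ (refl , refl) = refl
  ... | inj₂ e = ⊥-elim (true≢false (trans (sym (proj₂ (usesEdge⇒ y (x ∷ xs) e))) u∉))

  localView : ∀ vs → IsPath T vs → LocalView vs
  localView vs path with hasU vs in u∈
  ... | true = viaU u∈
  ... | false with any? (λ y → leafAtW y ∧ hasW y vs Bool.≟ true)
  ...   | yes (y , e) = leafPath y (∧-true⁻ˡ e) (leaf-path-avoiding-u vs y path (∧-true⁻ˡ e) (∧-true⁻ʳ e) u∈)
  ...   | no none = away u∈ (λ y leaf → ¬true⇒false (λ w∈ → none (y , ∧-true⁺ leaf w∈)))
    where
    ¬true⇒false : ∀ {b} → b ≢ true → b ≡ false
    ¬true⇒false {false} _ = refl
    ¬true⇒false {true} b≢true = ⊥-elim (b≢true refl)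

  typeOf : ∀ {vs} → LocalView vs → Maybe LocalType
  typeOf {vs} (viaU _)       = just (throughType vs)
  typeOf (leafPath y _ _)    = just (leafOnly y)
  typeOf (away _ _)          = nothing

  typeOf-weight : ∀ vs → IsPath T vs → (v : LocalView vs) → maybeWeight leafPattern (typeOf v) ≤ endpointsAt u vs
  typeOf-weight (x ∷ xs) path (viaU u∈) = weight-through x xs path u∈
  typeOf-weight _ _ (leafPath y leaf refl) rewrite attach-w leaf | ==-refl u = ≤-refl
  typeOf-weight _ _ (away _ _) = z≤n

  edgeTo : Fin n → Elem T
  edgeTo z with u <? z
  ... | yes _ = edg u z
  ... | no _  = edg z u

  containsList-edgeTo : ∀ vs z → containsList vs (edgeTo z) ≡ hasEdge T u z vs
  containsList-edgeTo vs z with u <? z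
  ... | yes _ = refl
  ... | no _  = hasEdge-sym z u vs

  localElement : Fin 4 → Elem T
  localElement zero    = vtx u
  localElement (suc y) = if leafAtW y then vtx (w y) else edgeTo (w y)

  hasW≡usesEdge : ∀ x xs y → IsPath T (x ∷ xs) → hasU (x ∷ xs) ≡ true → leafAtW y ≡ true →
    hasW y (x ∷ xs) ≡ usesEdge y (x ∷ xs)
  hasW≡usesEdge x xs y path u∈ leaf with hasW y (x ∷ xs) in w∈ | usesEdge y (x ∷ xs) in e
  ... | true  | true  = refl
  ... | false | false = refl
  ... | false | true  = trans (sym w∈) (proj₁ (usesEdge⇒ y (x ∷ xs) e))
  ... | true  | false with leaf-on-path x xs y path leaf w∈
  ...   | inj₂ e′ = trans (sym e′) e
  ...   | inj₁ (refl , refl) rewrite ≢⇒==false (u≢w y) = sym u∈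

  typeOf-contains : ∀ vs → IsPath T vs → (v : LocalView vs) →
    ∀ s → containsList vs (localElement s) ≡ maybeContains leafPattern (typeOf v) s
  typeOf-contains vs _ (viaU u∈) zero = u∈
  typeOf-contains (x ∷ xs) path (viaU u∈) (suc y) = trans (via-u y) (sym (triple-η (λ y → usesEdge y (x ∷ xs)) y))
    where
    via-u : ∀ y → containsList (x ∷ xs) (localElement (suc y)) ≡ usesEdge y (x ∷ xs)
    via-u y with leafAtW y in leaf
    ... | true  = hasW≡usesEdge x xs y path u∈ leaf
    ... | false = containsList-edgeTo (x ∷ xs) (w y)
  typeOf-contains _ _ (leafPath y leaf refl) zero rewrite ≢⇒==false (u≢w y) = refl
  typeOf-contains _ _ (leafPath y leaf refl) (suc y′) with y′ ≟ y
  ... | yes refl rewrite leaf | ==-refl (w y) = sym (trans (triple-η leafAtW y) leaf)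
  ... | no y′≢y with leafAtW y′
  ...   | true  rewrite ≢⇒==false (y′≢y ∘ w-injective y′ y) = refl
  ...   | false = containsList-edgeTo (w y ∷ []) (w y′)
  typeOf-contains vs _ (away u∉ none) zero = u∉
  typeOf-contains vs _ (away u∉ none) (suc y) with leafAtW y in leaf
  ... | true  = none y leaf
  ... | false = trans (containsList-edgeTo vs (w y)) (usesEdge-false y vs u∉)

  edgeTo-InVE* : ∀ z → Adj T u z → isLeaf T z ≡ false → InVE* T (edgeTo z)
  edgeTo-InVE* z a z-interior with u <? z
  ... | yes u<z = isInteriorEdge-intro u<z a u-interior z-interior
  ... | no u≮z = isInteriorEdge-intro z<u (Adj-sym a) z-interior u-interior
    where
    z<u : z <ᶠ u
    z<u with <-cmp u z
    ... | tri< u<z _ _ = ⊥-elim (u≮z u<z)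
    ... | tri≈ _ u≡z _ = ⊥-elim (Adj-irrefl (subst (Adj T u) (sym u≡z) a))
    ... | tri> _ _ z<u = z<u

  localElement-InVE* : ∀ s → InVE* T (localElement s)
  localElement-InVE* zero = tt
  localElement-InVE* (suc y) with leafAtW y in leaf
  ... | true  = tt
  ... | false = edgeTo-InVE* (w y) (Adj-w y) leaf

  private
    edg-injective : ∀ {a b c d} → _≡_ {A = Elem T} (edg a b) (edg c d) → a ≡ c × b ≡ d
    edg-injective refl = refl , refl

    vtx-injective : ∀ {a b} → _≡_ {A = Elem T} (vtx a) (vtx b) → a ≡ b
    vtx-injective refl = refl

  edgeTo≢vtx : ∀ z v → edgeTo z ≢ vtx v
  edgeTo≢vtx z v with u <? z
  ... | yes _ = λ ()
  ... | no _  = λ ()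

  edgeTo-injective : ∀ z z′ → u ≢ z → u ≢ z′ → edgeTo z ≡ edgeTo z′ → z ≡ z′
  edgeTo-injective z z′ u≢z u≢z′ e with u <? z | u <? z′
  ... | yes _ | yes _ = proj₂ (edg-injective e)
  ... | yes _ | no _  = ⊥-elim (u≢z′ (proj₁ (edg-injective e)))
  ... | no _  | yes _ = ⊥-elim (u≢z (sym (proj₁ (edg-injective e))))
  ... | no _  | no _  = proj₁ (edg-injective e)

  localElement-injective : ∀ s s′ → s ≢ s′ → localElement s ≢ localElement s′
  localElement-injective zero    zero     s≢s′ = ⊥-elim (s≢s′ refl)
  localElement-injective zero    (suc y)  _    = u≢neighbour y
    where
    u≢neighbour : ∀ y → localElement zero ≢ localElement (suc y)
    u≢neighbour y with leafAtW y
    ... | true  = u≢w y ∘ vtx-injective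
    ... | false = edgeTo≢vtx (w y) u ∘ sym
  localElement-injective (suc y) zero     s≢s′ = localElement-injective zero (suc y) (s≢s′ ∘ sym) ∘ sym
  localElement-injective (suc y) (suc y′) s≢s′ with leafAtW y | leafAtW y′
  ... | true  | true  = s≢s′ ∘ cong suc ∘ w-injective y y′ ∘ vtx-injective
  ... | true  | false = edgeTo≢vtx (w y′) (w y) ∘ sym
  ... | false | true  = edgeTo≢vtx (w y) (w y′)
  ... | false | false = s≢s′ ∘ cong suc ∘ w-injective y y′ ∘ edgeTo-injective (w y) (w y′) (u≢w y) (u≢w y′)

  family-bound : ∀ k (𝓕 : Fin k → Path T) → Separates T 𝓕 (InVE* T) → Covers T 𝓕 (InVE* T) →
    2 * #leavesIn leafPattern ≤ ∑[ i < k ] endpointsAt u (verts (𝓕 i))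
  family-bound k 𝓕 separates covers =
    ≤-trans (local-bound (leafAtW zero) (leafAtW (suc zero)) (leafAtW (suc (suc zero))) k τ local-separates local-covers)
            (∑-mono-≤ (λ i → typeOf-weight (verts (𝓕 i)) (isPath (𝓕 i)) (view i)))
    where
    view : ∀ i → LocalView (verts (𝓕 i))
    view i = localView (verts (𝓕 i)) (isPath (𝓕 i))
    τ : Fin k → Maybe LocalType
    τ i = typeOf (view i)
    contains≡ : ∀ i s → contains T (𝓕 i) (localElement s) ≡ maybeContains leafPattern (τ i) s
    contains≡ i s =
      trans (contains≡containsList (𝓕 i) (localElement s)) (typeOf-contains (verts (𝓕 i)) (isPath (𝓕 i)) (view i) s)
    local-separates : ∀ s s′ → s ≢ s′ → ∃ λ i → maybeContains leafPattern (τ i) s ≢ maybeContains leafPattern (τ i) s′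
    local-separates s s′ s≢s′ with tabulate-≢⇒∃ _ _
      (separates _ _ (localElement-InVE* s) (localElement-InVE* s′) (localElement-injective s s′ s≢s′))
    ... | i , d = i , λ e → d (trans (contains≡ i s) (trans e (sym (contains≡ i s′))))
    local-covers : ∀ s → ∃ λ i → maybeContains leafPattern (τ i) s ≡ true
    local-covers s with tabulate-≢⇒∃ _ (λ _ → false) (λ e → covers _ (localElement-InVE* s) (trans e (tabulate-false k)))
    ... | i , d = i , trans (sym (contains≡ i s)) (¬false d)
      where
      ¬false : ∀ {b} → b ≢ false → b ≡ true
      ¬false {true}  _ = refl
      ¬false {false} b≢false = ⊥-elim (b≢false refl)

  attachedLeaves≤#leavesIn : attachedLeaves u ≤ #leavesIn leafPattern
  attachedLeaves≤#leavesIn = begin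
      ∑[ l < n ] 𝟙 (isLeaf T l ∧ attach l == u)
    ≤⟨ ∑-mono-≤ attached≤ ⟩
      ∑[ l < n ] ∑[ y < 3 ] 𝟙 (leafAtW y ∧ w y == l)
    ≡⟨ ∑-comm (λ l y → 𝟙 (leafAtW y ∧ w y == l)) ⟩
      ∑[ y < 3 ] ∑[ l < n ] 𝟙 (leafAtW y ∧ w y == l)
    ≡⟨ sum-cong-≗ (λ y → trans (∑-𝟙-∧-== (leafAtW y) (w y)) (cong 𝟙 (sym (triple-η leafAtW y)))) ⟩
      #leavesIn leafPattern ∎
    where
    open ≤-Reasoning
    attached≤ : ∀ l → 𝟙 (isLeaf T l ∧ attach l == u) ≤ ∑[ y < 3 ] 𝟙 (leafAtW y ∧ w y == l)
    attached≤ l with isLeaf T l ∧ attach l == u in e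
    ... | false = z≤n
    ... | true with w-onto l (Adj-sym (subst (Adj T l) (==⇒≡ (∧-true⁻ʳ e)) (proj₁ (attach-leaf (∧-true⁻ˡ e)))))
    ...   | y , refl = true⇒1≤∑𝟙 (λ y′ → leafAtW y′ ∧ w y′ == w y) y (∧-true⁺ (∧-true⁻ˡ e) (==-refl (w y)))

  2*attachedLeaves≤endpoints : ∀ k (𝓕 : Fin k → Path T) → Separates T 𝓕 (InVE* T) → Covers T 𝓕 (InVE* T) →
    2 * attachedLeaves u ≤ ∑[ i < k ] endpointsAt u (verts (𝓕 i))
  2*attachedLeaves≤endpoints k 𝓕 separates covers =
    ≤-trans (*-monoʳ-≤ 2 attachedLeaves≤#leavesIn) (family-bound k 𝓕 separates covers)

module LowerBound {n : ℕ} (T : Graph n) (connected : Connected T) (acyclic : Acyclic T) (n≥4 : 4 ≤ n)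
                  (cubic : ∀ v → deg T v ≡ 1 ⊎ deg T v ≡ 3) where
  open CubicTree T connected acyclic n≥4 cubic

  2*attachedLeaves≤endpoints : ∀ k (𝓕 : Fin k → Path T) → Separates T 𝓕 (InVE* T) → Covers T 𝓕 (InVE* T) →
    ∀ u → 2 * attachedLeaves u ≤ ∑[ i < k ] endpointsAt u (verts (𝓕 i))
  2*attachedLeaves≤endpoints k 𝓕 separates covers u with isLeaf T u in u-leaf
  ... | true rewrite attachedLeaves-leaf u-leaf = z≤n
  ... | false = local (count≡3⇒enumeration (adj T u) (trans (sym (deg≡∑ u)) (interior⇒deg≡3 u-leaf)))
    where
    local : (Σ (Fin 3 → Fin n) λ w → (∀ y → Adj T u (w y)) × (∀ y y′ → w y ≡ w y′ → y ≡ y′) ×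
                                     (∀ z → Adj T u z → ∃ λ y → z ≡ w y)) →
            2 * attachedLeaves u ≤ ∑[ i < k ] endpointsAt u (verts (𝓕 i))
    local (w , Adj-w , w-injective , w-onto) =
      LocalBound.2*attachedLeaves≤endpoints T connected acyclic n≥4 cubic u u-leaf w Adj-w w-injective w-onto
        k 𝓕 separates covers

  -- each path has two endpoints, and each endpoint is attached to a single vertex
  #leaves≤k : ∀ k (𝓕 : Fin k → Path T) → Separates T 𝓕 (InVE* T) → Covers T 𝓕 (InVE* T) → #leaves ≤ k
  #leaves≤k k 𝓕 separates covers = *-cancelˡ-≤ 2 (begin
      2 * #leaves
    ≡⟨ cong (2 *_) (sym ∑attachedLeaves≡#leaves) ⟩
      2 * ∑[ u < n ] attachedLeaves u
    ≡⟨ *-distribˡ-sum 2 attachedLeaves ⟩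
      ∑[ u < n ] (2 * attachedLeaves u)
    ≤⟨ ∑-mono-≤ (2*attachedLeaves≤endpoints k 𝓕 separates covers) ⟩
      ∑[ u < n ] ∑[ i < k ] endpointsAt u (verts (𝓕 i))
    ≡⟨ ∑-comm (λ u i → endpointsAt u (verts (𝓕 i))) ⟩
      ∑[ i < k ] ∑[ u < n ] endpointsAt u (verts (𝓕 i))
    ≤⟨ ∑-mono-≤ (λ i → ∑endpointsAt≤2 (verts (𝓕 i))) ⟩
      ∑[ i < k ] 2
    ≡⟨ sym (*-distribˡ-sum {k} 2 (λ _ → 1)) ⟩
      2 * ∑[ i < k ] 1
    ≡⟨ cong (2 *_) (∑-one k) ⟩
      2 * k ∎)
    where open ≤-Reasoning

lemma6p5 : {n : ℕ} (T : Graph n) → IsTree T → 4 ≤ n →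
    (∀ v → deg T v ≡ 1 ⊎ deg T v ≡ 3) →
    ((k : ℕ) (𝓕 : Fin k → Path T) →
      Separates T 𝓕 (InVE* T) → Covers T 𝓕 (InVE* T) → h₁ T ≤ k)
    × (h₁ T ≡ numInteriorEdges T + 3)
lemma6p5 T (_ , connected , acyclic) n≥4 cubic =
  (λ k 𝓕 separates covers → subst (_≤ k) (sym h₁≡#leaves) (#leaves≤k k 𝓕 separates covers)) ,
  trans h₁≡#leaves (trans #leaves≡#interiorEdges+3 (cong (_+ 3) (sym numInteriorEdges≡#interiorEdges)))
  where
  open CubicTree T connected acyclic n≥4 cubic
  open LowerBound T connected acyclic n≥4 cubic
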